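{- Let $Y_0=\{y_k\}_{k\ge0}$, $Y=\{y_k\}_{k\ge1}$; for words $w=y_{s_1}\cdots y_{s_r}$ over $Y_0$ put $\operatorname{Li}^-_w(z)=\sum_{n_1>\cdots>n_r>0}n_1^{s_1}\cdots n_r^{s_r}z^{n_1}$ ($|z|<1$) and $\mathrm{H}^-_w(N)=\sum_{N\ge n_1>\cdots>n_r>0}n_1^{s_1}\cdots n_r^{s_r}$ ($N\in\mathbb{N}$), with $\operatorname{Li}^-_{1_{Y_0^*}}=\mathrm{H}^-_{1_{Y_0^*}}=1$, both extended linearly to $\mathbb{Q}\langle Y_0\rangle$. Let $\top$ be the product defined in the context. Then: (1) For all $P,Q\in\mathbb{Q}\langle Y\rangle\oplus\mathbb{Q}y_0$ with $\operatorname{Li}^-_P\not\equiv0$, $\operatorname{Li}^-_Q\not\equiv0$, one has $B^-_PB^-_Q=B^-_{P\top Q}$. (2) For $u,v\in Y_0^*$, the coefficient $\langle u\top v\mid1_{Y_0^*}\rangle$ is nonzero if and only if $u=v=1_{Y_0^*}$. (3) For all $u,v\in Y_0^*$, $y_0u\top v=u\top y_0v=y_0\top(u\top v)$; and for $w=y_{s_1}\cdots y_{s_r}\in Y_0^*$ with $r\ge2$, $w\top1_{Y_0^*}=\sum_{i=0}^{s_1}\binom{s_1}{i}\,y_i\top y_{s_1+s_2-i}y_{s_3}\cdots y_{s_r}$. (4) The map $\mathrm{H}^-_\bullet:(\mathbb{Q}\langle Y_0\rangle,\ast)\to(\mathbb{Q}\{\mathrm{H}^-_w\}_{w\in Y_0^*},\cdot)$,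 $P\mapsto\mathrm{H}^-_P$, is onto, and $\ker\mathrm{H}^-_\bullet=\ker\operatorname{Li}^-_\bullet$ equals the $\mathbb{Q}$-linear span of $\{w-w\top1_{Y_0^*}\mid w\in Y_0^*\}$.
   Context: Definition of $\top$: for words $u,v\in Y_0^*$ there is a unique element $u\top v=a_{1}(u,v)1_{Y_0^*}+\sum_{s\ge0}a_s(u,v)y_s$ of $\mathbb{Q}1_{Y_0^*}\oplus\bigoplus_{s\ge0}\mathbb{Q}y_s$ (finite sum, rational coefficients) with $\operatorname{Li}^-_{u\top v}=\operatorname{Li}^-_u\operatorname{Li}^-_v$; $\top$ is extended bilinearly to $\mathbb{Q}\langle Y_0\rangle$ (it is associative and commutative). For $P$ with $\operatorname{Li}^-_P\not\equiv0$, $\operatorname{Li}^-_P$ is a polynomial in $(1-z)^{ -1}$ and $B^-_P$ is its leading coefficient, i.e. $\operatorname{Li}^-_P(z)\sim B^-_P(1-z)^{ -n}$ as $z\to1$. The stuffle product: $w\ast1=1\ast w=w$, $y_iu\ast y_jv=y_j(y_iu\ast v)+y_i(u\ast y_jv)+y_{i+j}(u\ast v)$. $\mathbb{Q}\{\mathrm{H}^-_w\}$ denotes the $\mathbb{Q}$-span of the functions $\mathrm{H}^-_w$, $w\in Y_0^*$. -}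

module Defs where

open import Data.Nat as ℕ using (ℕ; zero; suc; _≤_)
open import Data.Nat.Combinatorics using (_C_)
open import Data.Integer using (+_)
open import Data.Rational using (ℚ; _/_; 0ℚ; 1ℚ; _+_; _*_; -_; _-_)
open import Data.List using (List; []; _∷_; _++_; map; concatMap; length)
open import Data.List.Properties using (≡-dec)
open import Data.Product using (Σ; _×_; _,_)
open import Data.Sum using (_⊎_)
open import Data.List.Relation.Unary.All using (All)
open import Relation.Nullary using (Dec; yes; no; ¬_)
open import Relation.Binary.PropositionalEquality using (_≡_)

-- Words over Y₀ = {y_k}_{k≥0}: the letter y_k is represented by k.
Word : Set
Word = List ℕ

-- Elements of ℚ⟨Y₀⟩ as finite formal linear combinations of words.
Poly : Set
Poly = List (ℚ × Word)

_≟w_ : (u v : Word) → Dec (u ≡ v)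
_≟w_ = ≡-dec ℕ._≟_

ι : ℕ → ℚ
ι n = (+ n) / 1

coeff : Poly → Word → ℚ
coeff [] w = 0ℚ
coeff ((c , u) ∷ P) w with u ≟w w
... | yes _ = c + coeff P w
... | no  _ = coeff P w

_≈_ : Poly → Poly → Set
P ≈ Q = ∀ w → coeff P w ≡ coeff Q w

word : Word → Poly
word w = (1ℚ , w) ∷ []

one : Poly
one = word []

scale : ℚ → Poly → Poly
scale c = map (λ { (d , u) → (c * d , u) })

neg : Poly → Poly
neg = scale (- 1ℚ)

prefix : ℕ → Poly → Poly
prefix s = map (λ { (d , u) → (d , s ∷ u) })

bilin : (Word → Word → Poly) → Poly → Poly → Poly
bilin f P Q = concatMap (λ { (c , u) → concatMap (λ { (d , v) → scale (c * d) (f u v) }) Q }) P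

sumℚ : ℕ → (ℕ → ℚ) → ℚ
sumℚ zero f = f zero
sumℚ (suc n) f = sumℚ n f + f (suc n)

sumP : ℕ → (ℕ → Poly) → Poly
sumP zero f = f zero
sumP (suc n) f = sumP n f ++ f (suc n)

H⁻w : Word → ℕ → ℚ
H⁻w [] N = 1ℚ
H⁻w (s ∷ w) zero = 0ℚ
H⁻w (s ∷ w) (suc N) = H⁻w (s ∷ w) N + ι (suc N ℕ.^ s) * H⁻w w N

H⁻ : Poly → ℕ → ℚ
H⁻ [] N = 0ℚ
H⁻ ((c , w) ∷ P) N = c * H⁻w w N + H⁻ P N

-- Li⁻_w as a formal power series in z: its coefficient of z^N is
-- Σ_{N = n₁ > ... > n_r > 0} n₁^{s₁} ... n_r^{s_r}  (and Li⁻_1 = 1)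
Li⁻w : Word → ℕ → ℚ
Li⁻w [] zero = 1ℚ
Li⁻w [] (suc N) = 0ℚ
Li⁻w (s ∷ w) zero = 0ℚ
Li⁻w (s ∷ w) (suc N) = ι (suc N ℕ.^ s) * H⁻w w N

Li⁻ : Poly → ℕ → ℚ
Li⁻ [] N = 0ℚ
Li⁻ ((c , w) ∷ P) N = c * Li⁻w w N + Li⁻ P N

_⋆_ : (ℕ → ℚ) → (ℕ → ℚ) → ℕ → ℚ
(f ⋆ g) n = sumℚ n (λ k → f k * g (n ℕ.∸ k))

IsZero : (ℕ → ℚ) → Set
IsZero f = ∀ N → f N ≡ 0ℚ

-- coefficient of z^n in (1-z)^{-k}
invPow : ℕ → ℕ → ℕ
invPow zero zero = 1
invPow zero (suc n) = 0
invPow (suc k) n = (n ℕ.+ k) C k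

-- Leading f b : f = Σ_{k=0}^{m} c_k (1-z)^{-k} with c_m = b ≠ 0,
-- i.e. b is the leading coefficient B⁻ of f as a polynomial in (1-z)^{-1}.
Leading : (ℕ → ℚ) → ℚ → Set
Leading f b =
  Σ ℕ λ m → Σ (ℕ → ℚ) λ c →
    (c m ≡ b) × (¬ (b ≡ 0ℚ)) ×
    (∀ n → f n ≡ sumℚ m (λ k → c k * ι (invPow k n)))

-- specification of ⊤ on words: u ⊤ v ∈ ℚ1 ⊕ ⊕_s ℚ y_s with Li⁻_{u⊤v} = Li⁻_u Li⁻_v
TopSpec : (Word → Word → Poly) → Set
TopSpec top = ∀ u v →
  (∀ w → 2 ≤ length w → coeff (top u v) w ≡ 0ℚ) ×
  (∀ N → Li⁻ (top u v) N ≡ (Li⁻w u ⋆ Li⁻w v) N)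

stw : Word → Word → Poly
stw [] v = word v
stw (i ∷ u) [] = word (i ∷ u)
stw (i ∷ u) (j ∷ v) =
  prefix j (stw (i ∷ u) v) ++ prefix i (stw u (j ∷ v)) ++ prefix (i ℕ.+ j) (stw u v)

_✱_ : Poly → Poly → Poly
_✱_ = bilin stw

InYplusY0 : Poly → Set
InYplusY0 P = ∀ w → ¬ (coeff P w ≡ 0ℚ) →
  All (λ s → 1 ≤ s) w ⊎ (w ≡ 0 ∷ [])

-- linear extension of a map on words: lin f (Σ c_i w_i) = Σ c_i f(w_i);
-- so { lin f L | L : Poly } is the ℚ-span of { f w | w ∈ Y₀* }
lin : (Word → Poly) → Poly → Poly
lin f = concatMap (λ { (c , w) → scale c (f w) })

module Submission where

open import Data.Nat as ℕ using (ℕ; zero; suc; _≤_; _<_; _∸_; _^_; z≤n; s≤s; _≤?_)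
import Data.Nat.Properties as ℕP
open import Data.Nat.Combinatorics using (_C_; nCn≡1; nCk+nC[k+1]≡[n+1]C[k+1]; k>n⇒nCk≡0)
import Data.Nat.Coprimality as Coprime
import Data.Integer as ℤ
import Data.Integer.Solver
open import Data.Rational as ℚ using (ℚ; 0ℚ; 1ℚ; _*_; _+_; -_; _-_; mkℚ; toℚᵘ; 1/_)
import Data.Rational.Properties as ℚP
import Data.Rational.Unnormalised as ℚᵘ
import Data.Rational.Unnormalised.Properties as ℚᵘP
open import Data.Rational.Solver using (module +-*-Solver)
open import Data.List using (List; []; _∷_; _++_; map; concatMap; length)
open import Data.List.Properties using (length-map)
open import Data.Product using (∃; _×_; _,_; proj₁; proj₂)
open import Data.Sum using (_⊎_; inj₁; inj₂)
open import Data.Empty using (⊥-elim)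
open import Function using (_∘_)
open import Function.Bundles using (_⇔_; mk⇔; module Equivalence)
open import Relation.Nullary using (¬_; yes; no)
open import Relation.Binary.Definitions using (tri<; tri≈; tri>)
open import Relation.Binary.PropositionalEquality
open import Defs

open +-*-Solver using (solve; _:+_; _:*_; _:-_; :-_; _:=_; con)
open ≡-Reasoning

-- ι n in normal form, the bridge to unnormalised arithmetic
ι-mkℚ : ∀ n → ι n ≡ mkℚ (ℤ.+ n) 0 (Coprime.sym (Coprime.1-coprimeTo n))
ι-mkℚ n = ℚP.normalize-coprime (Coprime.sym (Coprime.1-coprimeTo n))

ι-suc : ∀ n → ι (suc n) ≡ 1ℚ + ι n
ι-suc n = ℚP.toℚᵘ-injective (ℚᵘP.≃-trans (ℚᵘP.≃-reflexive (cong toℚᵘ (ι-mkℚ (suc n))))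
  (ℚᵘP.≃-trans (ℚᵘ.*≡* numerators)
  (ℚᵘP.≃-sym (ℚᵘP.≃-trans (ℚP.toℚᵘ-homo-+ 1ℚ (ι n))
    (ℚᵘP.≃-reflexive (cong (λ q → toℚᵘ 1ℚ ℚᵘ.+ toℚᵘ q) (ι-mkℚ n)))))))
  where
  open Data.Integer.Solver.+-*-Solver renaming (solve to solveℤ; con to conℤ; _:+_ to _⊕_; _:*_ to _⊗_; _:=_ to _≋_)
  numerators : (ℤ.+ 1 ℤ.+ ℤ.+ n) ℤ.* (ℤ.+ 1 ℤ.* ℤ.+ 1) ≡ (ℤ.+ 1 ℤ.* ℤ.+ 1 ℤ.+ ℤ.+ n ℤ.* ℤ.+ 1) ℤ.* ℤ.+ 1
  numerators = solveℤ 1 (λ x → (conℤ (ℤ.+ 1) ⊕ x) ⊗ (conℤ (ℤ.+ 1) ⊗ conℤ (ℤ.+ 1)) ≋ ((conℤ (ℤ.+ 1) ⊗ conℤ (ℤ.+ 1)) ⊕ x ⊗ conℤ (ℤ.+ 1)) ⊗ conℤ (ℤ.+ 1)) refl (ℤ.+ n)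

ι-+ : ∀ m n → ι (m ℕ.+ n) ≡ ι m + ι n
ι-+ zero n = sym (ℚP.+-identityˡ (ι n))
ι-+ (suc m) n = begin
  ι (suc (m ℕ.+ n))   ≡⟨ ι-suc (m ℕ.+ n) ⟩
  1ℚ + ι (m ℕ.+ n)    ≡⟨ cong (1ℚ +_) (ι-+ m n) ⟩
  1ℚ + (ι m + ι n)    ≡⟨ ℚP.+-assoc 1ℚ (ι m) (ι n) ⟨
  (1ℚ + ι m) + ι n    ≡⟨ cong (_+ ι n) (ι-suc m) ⟨
  ι (suc m) + ι n     ∎

ι-* : ∀ m n → ι (m ℕ.* n) ≡ ι m * ι n
ι-* zero n = sym (ℚP.*-zeroˡ (ι n))
ι-* (suc m) n = begin
  ι (n ℕ.+ m ℕ.* n)    ≡⟨ ι-+ n (m ℕ.* n) ⟩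
  ι n + ι (m ℕ.* n)    ≡⟨ cong (ι n +_) (ι-* m n) ⟩
  ι n + ι m * ι n      ≡⟨ solve 2 (λ a b → a :+ b :* a := (con 1ℚ :+ b) :* a) refl (ι n) (ι m) ⟩
  (1ℚ + ι m) * ι n     ≡⟨ cong (_* ι n) (ι-suc m) ⟨
  ι (suc m) * ι n      ∎

pow : ℚ → ℕ → ℚ
pow x zero = 1ℚ
pow x (suc s) = x * pow x s

ι-^ : ∀ a s → ι (a ^ s) ≡ pow (ι a) s
ι-^ a zero = refl
ι-^ a (suc s) = trans (ι-* a (a ^ s)) (cong (ι a *_) (ι-^ a s))

ι-suc≢0 : ∀ n → ι (suc n) ≢ 0ℚ
ι-suc≢0 n eq with trans (sym (ι-mkℚ (suc n))) eq
... | ()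

*-cancel-≢0 : ∀ x y → x ≢ 0ℚ → x * y ≡ 0ℚ → y ≡ 0ℚ
*-cancel-≢0 x y x≢0 xy≡0 = begin
  y                  ≡⟨ ℚP.*-identityˡ y ⟨
  1ℚ * y             ≡⟨ cong (_* y) (ℚP.*-inverseˡ x) ⟨
  (1/ x) * x * y     ≡⟨ ℚP.*-assoc (1/ x) x y ⟩
  (1/ x) * (x * y)   ≡⟨ cong ((1/ x) *_) xy≡0 ⟩
  (1/ x) * 0ℚ        ≡⟨ ℚP.*-zeroʳ (1/ x) ⟩
  0ℚ                 ∎
  where instance _ = ℚ.≢-nonZero x≢0

*-≢0 : ∀ x y → x ≢ 0ℚ → y ≢ 0ℚ → x * y ≢ 0ℚ
*-≢0 x y x≢0 y≢0 eq = y≢0 (*-cancel-≢0 x y x≢0 eq)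

-≡0⇒≡ : ∀ {p q} → p - q ≡ 0ℚ → p ≡ q
-≡0⇒≡ {p} {q} e = begin
  p              ≡⟨ solve 2 (λ p q → p := (p :- q) :+ q) refl p q ⟩
  (p - q) + q    ≡⟨ cong (_+ q) e ⟩
  0ℚ + q         ≡⟨ ℚP.+-identityˡ q ⟩
  q              ∎

sum-cong : ∀ n {f g : ℕ → ℚ} → (∀ k → k ≤ n → f k ≡ g k) → sumℚ n f ≡ sumℚ n g
sum-cong zero h = h 0 z≤n
sum-cong (suc n) h = cong₂ _+_ (sum-cong n (λ k k≤n → h k (ℕP.m≤n⇒m≤1+n k≤n))) (h (suc n) ℕP.≤-refl)

sum-0 : ∀ n {f : ℕ → ℚ} → (∀ k → k ≤ n → f k ≡ 0ℚ) → sumℚ n f ≡ 0ℚ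
sum-0 n {f} h = trans (sum-cong n h) (zeros n)
  where
  zeros : ∀ n → sumℚ n (λ _ → 0ℚ) ≡ 0ℚ
  zeros zero = refl
  zeros (suc n) = trans (cong (_+ 0ℚ) (zeros n)) (ℚP.+-identityˡ 0ℚ)

sum-+ : ∀ n (f g : ℕ → ℚ) → sumℚ n (λ k → f k + g k) ≡ sumℚ n f + sumℚ n g
sum-+ zero f g = refl
sum-+ (suc n) f g = trans (cong (_+ (f (suc n) + g (suc n))) (sum-+ n f g))
  (solve 4 (λ a b c d → (a :+ b) :+ (c :+ d) := (a :+ c) :+ (b :+ d)) refl
    (sumℚ n f) (sumℚ n g) (f (suc n)) (g (suc n)))

sum-*ˡ : ∀ n c (f : ℕ → ℚ) → sumℚ n (λ k → c * f k) ≡ c * sumℚ n f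
sum-*ˡ zero c f = refl
sum-*ˡ (suc n) c f = trans (cong (_+ (c * f (suc n))) (sum-*ˡ n c f)) (sym (ℚP.*-distribˡ-+ c _ _))

sum-*ʳ : ∀ n c (f : ℕ → ℚ) → sumℚ n (λ k → f k * c) ≡ sumℚ n f * c
sum-*ʳ n c f = trans (sum-cong n (λ k _ → ℚP.*-comm (f k) c)) (trans (sum-*ˡ n c f) (ℚP.*-comm c _))

sum-peel : ∀ n (f : ℕ → ℚ) → sumℚ (suc n) f ≡ f 0 + sumℚ n (f ∘ suc)
sum-peel zero f = refl
sum-peel (suc n) f = trans (cong (_+ f (suc (suc n))) (sum-peel n f)) (ℚP.+-assoc (f 0) _ _)

sum-reverse : ∀ n (f : ℕ → ℚ) → sumℚ n f ≡ sumℚ n (λ k → f (n ∸ k))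
sum-reverse zero f = refl
sum-reverse (suc n) f = begin
  sumℚ n f + f (suc n)                       ≡⟨ cong (_+ f (suc n)) (sum-reverse n f) ⟩
  sumℚ n (λ k → f (n ∸ k)) + f (suc n)       ≡⟨ ℚP.+-comm (sumℚ n (λ k → f (n ∸ k))) (f (suc n)) ⟩
  f (suc n) + sumℚ n (λ k → f (n ∸ k))       ≡⟨ sum-peel n (λ k → f (suc n ∸ k)) ⟨
  sumℚ (suc n) (λ k → f (suc n ∸ k))         ∎

sum-swap : ∀ n m (F : ℕ → ℕ → ℚ) →
  sumℚ n (λ i → sumℚ m (F i)) ≡ sumℚ m (λ k → sumℚ n (λ i → F i k))
sum-swap zero m F = refl
sum-swap (suc n) m F = trans (cong (_+ sumℚ m (F (suc n))) (sum-swap n m F))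
  (sym (sum-+ m (λ k → sumℚ n (λ i → F i k)) (F (suc n))))

sum-triangle : ∀ N (F : ℕ → ℕ → ℚ) →
  sumℚ N (λ n → sumℚ n (λ k → F k n)) ≡ sumℚ N (λ k → sumℚ (N ∸ k) (λ j → F k (k ℕ.+ j)))
sum-triangle zero F = refl
sum-triangle (suc N) F = begin
  sumℚ N (λ n → sumℚ n (λ k → F k n)) + (sumℚ N (λ k → F k (suc N)) + F (suc N) (suc N))
    ≡⟨ cong (_+ (sumℚ N (λ k → F k (suc N)) + F (suc N) (suc N))) (sum-triangle N F) ⟩
  Rows N + (sumℚ N (λ k → F k (suc N)) + F (suc N) (suc N))
    ≡⟨ ℚP.+-assoc (Rows N) _ _ ⟨
  (Rows N + sumℚ N (λ k → F k (suc N))) + F (suc N) (suc N)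
    ≡⟨ cong₂ _+_ (trans (sym (sum-+ N _ _)) (sum-cong N extendRow)) (cong (F (suc N)) (sym (ℕP.+-identityʳ (suc N)))) ⟩
  sumℚ N (λ k → sumℚ (suc N ∸ k) (λ j → F k (k ℕ.+ j))) + sumℚ 0 (λ j → F (suc N) (suc N ℕ.+ j))
    ≡⟨ cong (λ z → sumℚ N (λ k → sumℚ (suc N ∸ k) (λ j → F k (k ℕ.+ j))) + sumℚ z (λ j → F (suc N) (suc N ℕ.+ j)))
            (sym (ℕP.n∸n≡0 N)) ⟩
  sumℚ (suc N) (λ k → sumℚ (suc N ∸ k) (λ j → F k (k ℕ.+ j))) ∎
  where
  Rows : ℕ → ℚ
  Rows N = sumℚ N (λ k → sumℚ (N ∸ k) (λ j → F k (k ℕ.+ j)))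
  extendRow : ∀ k → k ≤ N →
    sumℚ (N ∸ k) (λ j → F k (k ℕ.+ j)) + F k (suc N) ≡ sumℚ (suc N ∸ k) (λ j → F k (k ℕ.+ j))
  extendRow k k≤N rewrite ℕP.+-∸-assoc 1 k≤N =
    cong (λ z → sumℚ (N ∸ k) (λ j → F k (k ℕ.+ j)) + F k z)
      (trans (cong suc (sym (ℕP.m+[n∸m]≡n k≤N))) (sym (ℕP.+-suc k (N ∸ k))))

sum-single : ∀ n p (f : ℕ → ℚ) → p ≤ n → (∀ k → k ≤ n → k ≢ p → f k ≡ 0ℚ) → sumℚ n f ≡ f p
sum-single zero zero f _ h = refl
sum-single (suc n) p f p≤ h with p ℕ.≟ suc n
... | yes refl = trans (cong (_+ f (suc n)) (sum-0 n (λ k k≤n → h k (ℕP.m≤n⇒m≤1+n k≤n) (λ { refl → ℕP.1+n≰n k≤n }))))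
                       (ℚP.+-identityˡ _)
... | no p≢ = trans (cong₂ _+_ (sum-single n p f (ℕP.≤-pred (ℕP.≤∧≢⇒< p≤ p≢)) (λ k k≤n → h k (ℕP.m≤n⇒m≤1+n k≤n)))
                               (h (suc n) ℕP.≤-refl (λ e → p≢ (sym e))))
                    (ℚP.+-identityʳ _)

sum-extend : ∀ d m (f : ℕ → ℚ) → (∀ k → m < k → f k ≡ 0ℚ) → sumℚ (m ℕ.+ d) f ≡ sumℚ m f
sum-extend zero m f h = cong (λ z → sumℚ z f) (ℕP.+-identityʳ m)
sum-extend (suc d) m f h rewrite ℕP.+-suc m d =
  trans (cong₂ _+_ (sum-extend d m f h) (h (suc (m ℕ.+ d)) (s≤s (ℕP.m≤m+n m d)))) (ℚP.+-identityʳ _)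

infix 4 _≐_
_≐_ : (ℕ → ℚ) → (ℕ → ℚ) → Set
f ≐ g = ∀ n → f n ≡ g n

δ : ℕ → ℚ
δ zero = 1ℚ
δ (suc n) = 0ℚ

⋆-cong : ∀ {f f′ g g′} → f ≐ f′ → g ≐ g′ → (f ⋆ g) ≐ (f′ ⋆ g′)
⋆-cong ef eg n = sum-cong n (λ k _ → cong₂ _*_ (ef k) (eg (n ∸ k)))

⋆-comm : ∀ f g → (f ⋆ g) ≐ (g ⋆ f)
⋆-comm f g n = trans (sum-reverse n (λ k → f k * g (n ∸ k)))
  (sum-cong n (λ k k≤n → trans (cong (λ z → f (n ∸ k) * g z) (ℕP.m∸[m∸n]≡n k≤n)) (ℚP.*-comm (f (n ∸ k)) (g k))))

⋆-identityʳ : ∀ f → (f ⋆ δ) ≐ f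
⋆-identityʳ f n = trans (sum-single n n (λ k → f k * δ (n ∸ k)) ℕP.≤-refl offDiagonal)
  (trans (cong (λ z → f n * δ z) (ℕP.n∸n≡0 n)) (ℚP.*-identityʳ (f n)))
  where
  offDiagonal : ∀ k → k ≤ n → k ≢ n → f k * δ (n ∸ k) ≡ 0ℚ
  offDiagonal k k≤n k≢n with n ∸ k in eq
  ... | zero = ⊥-elim (k≢n (ℕP.≤-antisym k≤n (ℕP.m∸n≡0⇒m≤n eq)))
  ... | suc _ = ℚP.*-zeroʳ (f k)

⋆-assoc : ∀ f g h → ((f ⋆ g) ⋆ h) ≐ (f ⋆ (g ⋆ h))
⋆-assoc f g h N = begin
  sumℚ N (λ n → sumℚ n (λ k → f k * g (n ∸ k)) * h (N ∸ n))
    ≡⟨ sum-cong N (λ n _ → sym (sum-*ʳ n (h (N ∸ n)) (λ k → f k * g (n ∸ k)))) ⟩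
  sumℚ N (λ n → sumℚ n (λ k → f k * g (n ∸ k) * h (N ∸ n)))
    ≡⟨ sum-triangle N (λ k n → f k * g (n ∸ k) * h (N ∸ n)) ⟩
  sumℚ N (λ k → sumℚ (N ∸ k) (λ j → f k * g (k ℕ.+ j ∸ k) * h (N ∸ (k ℕ.+ j))))
    ≡⟨ sum-cong N (λ k _ → trans (sum-cong (N ∸ k) (λ j _ → trans
         (cong₂ (λ a b → f k * g a * h b) (ℕP.m+n∸m≡n k j) (sym (ℕP.∸-+-assoc N k j)))
         (ℚP.*-assoc (f k) (g j) (h (N ∸ k ∸ j)))))
         (sum-*ˡ (N ∸ k) (f k) (λ j → g j * h (N ∸ k ∸ j)))) ⟩
  sumℚ N (λ k → f k * sumℚ (N ∸ k) (λ j → g j * h (N ∸ k ∸ j))) ∎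

⋆-zeroˡ : ∀ g → ((λ _ → 0ℚ) ⋆ g) ≐ (λ _ → 0ℚ)
⋆-zeroˡ g n = sum-0 n (λ k _ → ℚP.*-zeroˡ (g (n ∸ k)))

⋆-+ˡ : ∀ f g h → ((λ n → f n + g n) ⋆ h) ≐ (λ n → (f ⋆ h) n + (g ⋆ h) n)
⋆-+ˡ f g h n = trans (sum-cong n (λ k _ → ℚP.*-distribʳ-+ (h (n ∸ k)) (f k) (g k))) (sum-+ n _ _)

⋆-*ˡ : ∀ c f h → ((λ n → c * f n) ⋆ h) ≐ (λ n → c * (f ⋆ h) n)
⋆-*ˡ c f h n = trans (sum-cong n (λ k _ → ℚP.*-assoc c (f k) (h (n ∸ k)))) (sum-*ˡ n c _)

⋆-sumˡ : ∀ m (F : ℕ → ℕ → ℚ) h →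
  ((λ n → sumℚ m (λ k → F k n)) ⋆ h) ≐ (λ n → sumℚ m (λ k → (F k ⋆ h) n))
⋆-sumˡ m F h n = trans (sum-cong n (λ i _ → sym (sum-*ʳ m (h (n ∸ i)) (λ k → F k i))))
  (sum-swap n m (λ i k → F k i * h (n ∸ i)))

geom : ℕ → ℕ → ℚ
geom k n = ι (invPow k n)

geom-zero : geom 0 ≐ δ
geom-zero zero = refl
geom-zero (suc n) = refl

invPow-pascal : ∀ k n → invPow (suc k) (suc n) ≡ invPow (suc k) n ℕ.+ invPow k (suc n)
invPow-pascal zero n = refl
invPow-pascal (suc k) n = begin
  (suc n ℕ.+ suc k) C suc k                       ≡⟨ cong (λ z → suc z C suc k) (ℕP.+-suc n k) ⟩
  suc (suc (n ℕ.+ k)) C suc k                     ≡⟨ nCk+nC[k+1]≡[n+1]C[k+1] (suc (n ℕ.+ k)) k ⟨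
  suc (n ℕ.+ k) C k ℕ.+ suc (n ℕ.+ k) C suc k     ≡⟨ ℕP.+-comm (suc (n ℕ.+ k) C k) _ ⟩
  suc (n ℕ.+ k) C suc k ℕ.+ suc (n ℕ.+ k) C k     ≡⟨ cong (λ z → z C suc k ℕ.+ suc (n ℕ.+ k) C k) (ℕP.+-suc n k) ⟨
  (n ℕ.+ suc k) C suc k ℕ.+ (suc n ℕ.+ k) C k     ∎

invPow-at-zero : ∀ k → invPow (suc k) 0 ≡ invPow k 0
invPow-at-zero zero = refl
invPow-at-zero (suc k) = trans (nCn≡1 (suc k)) (sym (nCn≡1 k))

geom-partialSum : ∀ k n → geom (suc k) n ≡ sumℚ n (geom k)
geom-partialSum k zero = cong ι (invPow-at-zero k)
geom-partialSum k (suc n) = trans (cong ι (invPow-pascal k n))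
  (trans (ι-+ (invPow (suc k) n) (invPow k (suc n))) (cong (_+ geom k (suc n)) (geom-partialSum k n)))

-- partial sums are products with geom 1 = Σ z^n
geom-suc : ∀ k → geom (suc k) ≐ (geom k ⋆ geom 1)
geom-suc k n = trans (geom-partialSum k n) (sum-cong n (λ i _ → sym (ℚP.*-identityʳ (geom k i))))

geom-+ : ∀ k l → (geom k ⋆ geom l) ≐ geom (k ℕ.+ l)
geom-+ k zero n = begin
  (geom k ⋆ geom 0) n   ≡⟨ ⋆-cong {f = geom k} (λ _ → refl) geom-zero n ⟩
  (geom k ⋆ δ) n        ≡⟨ ⋆-identityʳ (geom k) n ⟩
  geom k n              ≡⟨ cong (λ z → geom z n) (ℕP.+-identityʳ k) ⟨
  geom (k ℕ.+ 0) n      ∎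
geom-+ k (suc l) n = begin
  (geom k ⋆ geom (suc l)) n          ≡⟨ ⋆-cong {f = geom k} (λ _ → refl) (geom-suc l) n ⟩
  (geom k ⋆ (geom l ⋆ geom 1)) n     ≡⟨ ⋆-assoc (geom k) (geom l) (geom 1) n ⟨
  ((geom k ⋆ geom l) ⋆ geom 1) n     ≡⟨ ⋆-cong {g = geom 1} (geom-+ k l) (λ _ → refl) n ⟩
  (geom (k ℕ.+ l) ⋆ geom 1) n        ≡⟨ geom-suc (k ℕ.+ l) n ⟨
  geom (suc (k ℕ.+ l)) n             ≡⟨ cong (λ z → geom z n) (ℕP.+-suc k l) ⟨
  geom (k ℕ.+ suc l) n               ∎

Expansion : ℕ → (ℕ → ℚ) → (ℕ → ℚ) → Set
Expansion m c f = f ≐ (λ n → sumℚ m (λ k → c k * geom k n))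

SupportedBy : ℕ → (ℕ → ℚ) → Set
SupportedBy m c = ∀ k → m < k → c k ≡ 0ℚ

truncate : ℕ → (ℕ → ℚ) → ℕ → ℚ
truncate m c k with k ≤? m
... | yes _ = c k
... | no _ = 0ℚ

truncate-≤ : ∀ m (c : ℕ → ℚ) k → k ≤ m → truncate m c k ≡ c k
truncate-≤ m c k k≤m with k ≤? m
... | yes _ = refl
... | no k≰m = ⊥-elim (k≰m k≤m)

truncate-supported : ∀ m (c : ℕ → ℚ) → SupportedBy m (truncate m c)
truncate-supported m c k m<k with k ≤? m
... | yes k≤m = ⊥-elim (ℕP.<⇒≱ m<k k≤m)
... | no _ = refl

expansion-truncate : ∀ m (c f : ℕ → ℚ) → Expansion m c f → Expansion m (truncate m c) f
expansion-truncate m c f e n =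
  trans (e n) (sum-cong m (λ k k≤m → cong (_* geom k n) (sym (truncate-≤ m c k k≤m))))

⋆-expansions : ∀ m (c : ℕ → ℚ) m′ (d : ℕ → ℚ) →
  ((λ n → sumℚ m (λ k → c k * geom k n)) ⋆ (λ n → sumℚ m′ (λ l → d l * geom l n))) ≐
  (λ n → sumℚ m (λ k → sumℚ m′ (λ l → (c k * d l) * geom (k ℕ.+ l) n)))
⋆-expansions m c m′ d n = trans (expandLeft m c G n) (sum-cong m (λ k _ → row k))
  where
  expandLeft : ∀ m (c g : ℕ → ℚ) → ((λ n → sumℚ m (λ k → c k * geom k n)) ⋆ g) ≐ (λ n → sumℚ m (λ k → c k * (geom k ⋆ g) n))
  expandLeft m c g n = trans (⋆-sumˡ m (λ k n → c k * geom k n) g n) (sum-cong m (λ k _ → ⋆-*ˡ (c k) (geom k) g n))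
  G : ℕ → ℚ
  G n = sumℚ m′ (λ l → d l * geom l n)
  row : ∀ k → c k * (geom k ⋆ G) n ≡ sumℚ m′ (λ l → (c k * d l) * geom (k ℕ.+ l) n)
  row k = begin
    c k * (geom k ⋆ G) n                           ≡⟨ cong (c k *_) (⋆-comm (geom k) G n) ⟩
    c k * (G ⋆ geom k) n                           ≡⟨ cong (c k *_) (expandLeft m′ d (geom k) n) ⟩
    c k * sumℚ m′ (λ l → d l * (geom l ⋆ geom k) n) ≡⟨ sum-*ˡ m′ (c k) _ ⟨
    sumℚ m′ (λ l → c k * (d l * (geom l ⋆ geom k) n))
      ≡⟨ sum-cong m′ (λ l _ → trans (sym (ℚP.*-assoc (c k) (d l) _))
           (cong ((c k * d l) *_) (trans (geom-+ l k n) (cong (λ z → geom z n) (ℕP.+-comm l k))))) ⟩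
    sumℚ m′ (λ l → (c k * d l) * geom (k ℕ.+ l) n) ∎

sum-diagonals : ∀ m (a : ℕ → ℚ) m′ (b : ℕ → ℚ) (F : ℕ → ℚ) → SupportedBy m a → SupportedBy m′ b →
  sumℚ m (λ k → sumℚ m′ (λ l → (a k * b l) * F (k ℕ.+ l))) ≡ sumℚ (m ℕ.+ m′) (λ j → (a ⋆ b) j * F j)
sum-diagonals m a m′ b F sa sb = begin
  sumℚ m (λ k → sumℚ m′ (Term k))         ≡⟨ sum-cong m (λ k k≤m → widenRow k k≤m) ⟩
  sumℚ m Row                              ≡⟨ sum-extend m′ m Row (λ k m<k → sum-0 (M ∸ k) (λ l _ → Term-left k l m<k)) ⟨
  sumℚ M Row
    ≡⟨ sum-cong M (λ k _ → sum-cong (M ∸ k) (λ l _ → cong (λ z → (a k * b z) * F (k ℕ.+ l)) (sym (ℕP.m+n∸m≡n k l)))) ⟩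
  sumℚ M (λ k → sumℚ (M ∸ k) (λ l → (a k * b (k ℕ.+ l ∸ k)) * F (k ℕ.+ l)))
    ≡⟨ sum-triangle M (λ k j → (a k * b (j ∸ k)) * F j) ⟨
  sumℚ M (λ j → sumℚ j (λ k → (a k * b (j ∸ k)) * F j))
    ≡⟨ sum-cong M (λ j _ → sum-*ʳ j (F j) (λ k → a k * b (j ∸ k))) ⟩
  sumℚ M (λ j → (a ⋆ b) j * F j)          ∎
  where
  M : ℕ
  M = m ℕ.+ m′
  Term : ℕ → ℕ → ℚ
  Term k l = (a k * b l) * F (k ℕ.+ l)
  Row : ℕ → ℚ
  Row k = sumℚ (M ∸ k) (Term k)
  Term-left : ∀ k l → m < k → Term k l ≡ 0ℚ
  Term-left k l m<k = trans (cong (λ z → (z * b l) * F (k ℕ.+ l)) (sa k m<k))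
    (solve 2 (λ x y → (con 0ℚ :* x) :* y := con 0ℚ) refl (b l) (F (k ℕ.+ l)))
  Term-right : ∀ k l → m′ < l → Term k l ≡ 0ℚ
  Term-right k l m′<l = trans (cong (λ z → (a k * z) * F (k ℕ.+ l)) (sb l m′<l))
    (solve 2 (λ x y → (x :* con 0ℚ) :* y := con 0ℚ) refl (a k) (F (k ℕ.+ l)))
  widenRow : ∀ k → k ≤ m → sumℚ m′ (Term k) ≡ Row k
  widenRow k k≤m = begin
    sumℚ m′ (Term k)                 ≡⟨ sum-extend (m ∸ k) m′ (Term k) (Term-right k) ⟨
    sumℚ (m′ ℕ.+ (m ∸ k)) (Term k)   ≡⟨ cong (λ z → sumℚ z (Term k)) (trans (ℕP.+-comm m′ (m ∸ k)) (sym (ℕP.+-∸-comm m′ k≤m))) ⟩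
    Row k                            ∎

⋆-corner : ∀ m (a : ℕ → ℚ) m′ (b : ℕ → ℚ) → SupportedBy m a → SupportedBy m′ b → (a ⋆ b) (m ℕ.+ m′) ≡ a m * b m′
⋆-corner m a m′ b sa sb =
  trans (sum-single (m ℕ.+ m′) m _ (ℕP.m≤m+n m m′) offCorner) (cong (λ z → a m * b z) (ℕP.m+n∸m≡n m m′))
  where
  offCorner : ∀ k → k ≤ m ℕ.+ m′ → k ≢ m → a k * b (m ℕ.+ m′ ∸ k) ≡ 0ℚ
  offCorner k _ k≢m with ℕ.<-cmp k m
  ... | tri≈ _ k≡m _ = ⊥-elim (k≢m k≡m)
  ... | tri> _ _ m<k = trans (cong (_* b (m ℕ.+ m′ ∸ k)) (sa k m<k)) (ℚP.*-zeroˡ (b (m ℕ.+ m′ ∸ k)))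
  ... | tri< k<m _ _ = trans (cong (a k *_) (sb (m ℕ.+ m′ ∸ k) m′<rest)) (ℚP.*-zeroʳ (a k))
    where
    m′<rest : m′ < m ℕ.+ m′ ∸ k
    m′<rest = subst (m′ <_) (sym (ℕP.+-∸-comm m′ (ℕP.<⇒≤ k<m)))
                    (ℕP.+-monoˡ-≤ m′ (ℕP.m<n⇒0<n∸m k<m))

expansion-⋆ : ∀ m (a : ℕ → ℚ) m′ (b : ℕ → ℚ) (f g : ℕ → ℚ) → SupportedBy m a → SupportedBy m′ b →
  Expansion m a f → Expansion m′ b g → Expansion (m ℕ.+ m′) (a ⋆ b) (f ⋆ g)
expansion-⋆ m a m′ b f g sa sb ef eg n = begin
  (f ⋆ g) n
    ≡⟨ ⋆-cong ef eg n ⟩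
  ((λ n → sumℚ m (λ k → a k * geom k n)) ⋆ (λ n → sumℚ m′ (λ l → b l * geom l n))) n
    ≡⟨ ⋆-expansions m a m′ b n ⟩
  sumℚ m (λ k → sumℚ m′ (λ l → (a k * b l) * geom (k ℕ.+ l) n))
    ≡⟨ sum-diagonals m a m′ b (λ j → geom j n) sa sb ⟩
  sumℚ (m ℕ.+ m′) (λ j → (a ⋆ b) j * geom j n) ∎

leading-⋆ : ∀ (f g : ℕ → ℚ) a b → Leading f a → Leading g b → Leading (f ⋆ g) (a * b)
leading-⋆ f g a b (m , c , cm≡a , a≢0 , ef) (m′ , d , dm′≡b , b≢0 , eg) =
  m ℕ.+ m′ , c′ ⋆ d′ , corner , *-≢0 a b a≢0 b≢0 ,
  expansion-⋆ m c′ m′ d′ f g (truncate-supported m c) (truncate-supported m′ d)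
    (expansion-truncate m c f ef) (expansion-truncate m′ d g eg)
  where
  c′ d′ : ℕ → ℚ
  c′ = truncate m c
  d′ = truncate m′ d
  corner : (c′ ⋆ d′) (m ℕ.+ m′) ≡ a * b
  corner = trans (⋆-corner m c′ m′ d′ (truncate-supported m c) (truncate-supported m′ d))
    (cong₂ _*_ (trans (truncate-≤ m c m ℕP.≤-refl) cm≡a) (trans (truncate-≤ m′ d m′ ℕP.≤-refl) dm′≡b))

Leading-resp : ∀ {f g b} → f ≐ g → Leading f b → Leading g b
Leading-resp f≐g (m , c , cm , b≢0 , e) = m , c , cm , b≢0 , λ n → trans (sym (f≐g n)) (e n)

-- Linear extension of word functions to ℚ⟨Y₀⟩:  linExt h (Σ cᵢ wᵢ) = Σ cᵢ h(wᵢ).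
-- Li⁻, H⁻ and coefficient extraction are all of this form.

linExt : (Word → ℚ) → Poly → ℚ
linExt h [] = 0ℚ
linExt h ((c , w) ∷ P) = c * h w + linExt h P

Li⁻-linExt : ∀ P N → Li⁻ P N ≡ linExt (λ w → Li⁻w w N) P
Li⁻-linExt [] N = refl
Li⁻-linExt ((c , w) ∷ P) N = cong (c * Li⁻w w N +_) (Li⁻-linExt P N)

H⁻-linExt : ∀ P N → H⁻ P N ≡ linExt (λ w → H⁻w w N) P
H⁻-linExt [] N = refl
H⁻-linExt ((c , w) ∷ P) N = cong (c * H⁻w w N +_) (H⁻-linExt P N)

linExt-cong : ∀ {f g} P → (∀ w → f w ≡ g w) → linExt f P ≡ linExt g P
linExt-cong [] h = refl
linExt-cong ((c , w) ∷ P) h = cong₂ _+_ (cong (c *_) (h w)) (linExt-cong P h)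

linExt-zero : ∀ {f} P → (∀ w → f w ≡ 0ℚ) → linExt f P ≡ 0ℚ
linExt-zero [] h = refl
linExt-zero ((c , w) ∷ P) h =
  trans (cong₂ _+_ (trans (cong (c *_) (h w)) (ℚP.*-zeroʳ c)) (linExt-zero P h)) (ℚP.+-identityˡ 0ℚ)

linExt-+* : ∀ f g a P → linExt (λ w → f w + a * g w) P ≡ linExt f P + a * linExt g P
linExt-+* f g a [] = sym (trans (cong (0ℚ +_) (ℚP.*-zeroʳ a)) (ℚP.+-identityˡ 0ℚ))
linExt-+* f g a ((c , w) ∷ P) = trans (cong (c * (f w + a * g w) +_) (linExt-+* f g a P))
  (solve 6 (λ c x a y p q → c :* (x :+ a :* y) :+ (p :+ a :* q) := (c :* x :+ p) :+ a :* (c :* y :+ q))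
    refl c (f w) a (g w) (linExt f P) (linExt g P))

linExt-- : ∀ f g P → linExt (λ w → f w - g w) P ≡ linExt f P - linExt g P
linExt-- f g P = trans (linExt-cong P (λ w → solve 2 (λ x y → x :- y := x :+ (:- con 1ℚ) :* y) refl (f w) (g w)))
  (trans (linExt-+* f g (- 1ℚ) P) (solve 2 (λ x y → x :+ (:- con 1ℚ) :* y := x :- y) refl (linExt f P) (linExt g P)))

linExt-* : ∀ c f P → linExt (λ w → c * f w) P ≡ c * linExt f P
linExt-* c f P = trans (linExt-cong P (λ w → sym (ℚP.+-identityˡ (c * f w))))
  (trans (linExt-+* (λ _ → 0ℚ) f c P) (trans (cong (_+ c * linExt f P) (linExt-zero P (λ _ → refl))) (ℚP.+-identityˡ _)))

linExt-sum : ∀ (F : Word → ℕ → ℚ) N P → linExt (λ w → sumℚ N (F w)) P ≡ sumℚ N (λ k → linExt (λ w → F w k) P)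
linExt-sum F N [] = sym (sum-0 N (λ _ _ → refl))
linExt-sum F N ((c , w) ∷ P) = trans (cong₂ _+_ (sym (sum-*ˡ N c (F w))) (linExt-sum F N P)) (sym (sum-+ N _ _))

linExt-++ : ∀ f P Q → linExt f (P ++ Q) ≡ linExt f P + linExt f Q
linExt-++ f [] Q = sym (ℚP.+-identityˡ _)
linExt-++ f ((c , w) ∷ P) Q = trans (cong (c * f w +_) (linExt-++ f P Q)) (sym (ℚP.+-assoc (c * f w) _ _))

linExt-scale : ∀ f c P → linExt f (scale c P) ≡ c * linExt f P
linExt-scale f c [] = sym (ℚP.*-zeroʳ c)
linExt-scale f c ((d , u) ∷ P) = trans (cong₂ _+_ (ℚP.*-assoc c d (f u)) (linExt-scale f c P))
  (sym (ℚP.*-distribˡ-+ c (d * f u) _))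

linExt-neg : ∀ f P → linExt f (neg P) ≡ - linExt f P
linExt-neg f P = trans (linExt-scale f (- 1ℚ) P) (solve 1 (λ x → (:- con 1ℚ) :* x := :- x) refl (linExt f P))

linExt-word : ∀ f w → linExt f (word w) ≡ f w
linExt-word f w = trans (ℚP.+-identityʳ _) (ℚP.*-identityˡ (f w))

linExt-prefix : ∀ f s P → linExt f (prefix s P) ≡ linExt (f ∘ (s ∷_)) P
linExt-prefix f s [] = refl
linExt-prefix f s ((d , u) ∷ P) = cong (d * f (s ∷ u) +_) (linExt-prefix f s P)

linExt-sumP : ∀ f n F → linExt f (sumP n F) ≡ sumℚ n (λ i → linExt f (F i))
linExt-sumP f zero F = refl
linExt-sumP f (suc n) F = trans (linExt-++ f (sumP n F) (F (suc n))) (cong (_+ linExt f (F (suc n))) (linExt-sumP f n F))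

linExt-lin : ∀ f g L → linExt f (lin g L) ≡ linExt (λ w → linExt f (g w)) L
linExt-lin f g [] = refl
linExt-lin f g ((c , w) ∷ L) = trans (linExt-++ f (scale c (g w)) _) (cong₂ _+_ (linExt-scale f c (g w)) (linExt-lin f g L))

linExt-bilin : ∀ f T P Q → linExt f (bilin T P Q) ≡ linExt (λ u → linExt (λ v → linExt f (T u v)) Q) P
linExt-bilin f T [] Q = refl
linExt-bilin f T ((c , u) ∷ P) Q =
  trans (linExt-++ f (concatMap (λ { (d , v) → scale (c * d) (T u v) }) Q) (bilin T P Q))
        (cong₂ _+_ (row Q) (linExt-bilin f T P Q))
  where
  row : ∀ Q′ → linExt f (concatMap (λ { (d , v) → scale (c * d) (T u v) }) Q′)
               ≡ c * linExt (λ v → linExt f (T u v)) Q′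
  row [] = sym (ℚP.*-zeroʳ c)
  row ((d , v) ∷ Q′) = begin
    linExt f (scale (c * d) (T u v) ++ concatMap (λ { (d , v) → scale (c * d) (T u v) }) Q′)
      ≡⟨ linExt-++ f (scale (c * d) (T u v)) _ ⟩
    linExt f (scale (c * d) (T u v)) + linExt f (concatMap (λ { (d , v) → scale (c * d) (T u v) }) Q′)
      ≡⟨ cong₂ _+_ (linExt-scale f (c * d) (T u v)) (row Q′) ⟩
    (c * d) * linExt f (T u v) + c * linExt (λ v → linExt f (T u v)) Q′
      ≡⟨ solve 4 (λ c d x y → (c :* d) :* x :+ c :* y := c :* (d :* x :+ y)) refl c d (linExt f (T u v)) _ ⟩
    c * (d * linExt f (T u v) + linExt (λ v → linExt f (T u v)) Q′) ∎

indicator : Word → Word → ℚ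
indicator w u with u ≟w w
... | yes _ = 1ℚ
... | no _ = 0ℚ

coeff-linExt : ∀ P w → coeff P w ≡ linExt (indicator w) P
coeff-linExt [] w = refl
coeff-linExt ((c , u) ∷ P) w with u ≟w w
... | yes _ = cong₂ _+_ (sym (ℚP.*-identityʳ c)) (coeff-linExt P w)
... | no _ = trans (coeff-linExt P w) (sym (trans (cong (_+ linExt (indicator w) P) (ℚP.*-zeroʳ c)) (ℚP.+-identityˡ _)))

coeff-++ : ∀ P Q w → coeff (P ++ Q) w ≡ coeff P w + coeff Q w
coeff-++ P Q w = trans (coeff-linExt (P ++ Q) w)
  (trans (linExt-++ (indicator w) P Q) (sym (cong₂ _+_ (coeff-linExt P w) (coeff-linExt Q w))))

coeff-neg : ∀ P w → coeff (neg P) w ≡ - coeff P w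
coeff-neg P w = trans (coeff-linExt (neg P) w) (trans (linExt-neg (indicator w) P) (cong -_ (sym (coeff-linExt P w))))

coeff-head : ∀ c u P → coeff ((c , u) ∷ P) u ≡ c + coeff P u
coeff-head c u P with u ≟w u
... | yes _ = refl
... | no u≢u = ⊥-elim (u≢u refl)

coeff-other : ∀ c u P w → u ≢ w → coeff ((c , u) ∷ P) w ≡ coeff P w
coeff-other c u P w u≢w with u ≟w w
... | yes u≡w = ⊥-elim (u≢w u≡w)
... | no _ = refl

remove : Word → Poly → Poly
remove u [] = []
remove u ((c , w) ∷ Z) with w ≟w u
... | yes _ = remove u Z
... | no _ = (c , w) ∷ remove u Z

-- removal shortens the list, so it can drive an induction
remove-length : ∀ u Z → length (remove u Z) ≤ length Z
remove-length u [] = z≤n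
remove-length u ((c , w) ∷ Z) with w ≟w u
... | yes _ = ℕP.m≤n⇒m≤1+n (remove-length u Z)
... | no _ = s≤s (remove-length u Z)

coeff-remove-self : ∀ u Z → coeff (remove u Z) u ≡ 0ℚ
coeff-remove-self u [] = refl
coeff-remove-self u ((c , w) ∷ Z) with w ≟w u
... | yes _ = coeff-remove-self u Z
... | no w≢u = trans (coeff-other c w (remove u Z) u w≢u) (coeff-remove-self u Z)

coeff-remove-other : ∀ u Z w → w ≢ u → coeff (remove u Z) w ≡ coeff Z w
coeff-remove-other u [] w _ = refl
coeff-remove-other u ((c , v) ∷ Z) w w≢u with v ≟w u
... | yes refl = trans (coeff-remove-other v Z w w≢u) (sym (coeff-other c v Z w (λ e → w≢u (sym e))))
... | no v≢u with v ≟w w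
...   | yes _ = cong (c +_) (coeff-remove-other u Z w w≢u)
...   | no _ = coeff-remove-other u Z w w≢u

linExt-collect : ∀ h u Z → linExt h Z ≡ coeff Z u * h u + linExt h (remove u Z)
linExt-collect h u [] = sym (trans (cong (_+ 0ℚ) (ℚP.*-zeroˡ (h u))) (ℚP.+-identityˡ 0ℚ))
linExt-collect h u ((c , w) ∷ Z) with w ≟w u
... | yes refl = trans (cong (c * h w +_) (linExt-collect h w Z))
       (solve 4 (λ c x y z → c :* x :+ (y :* x :+ z) := (c :+ y) :* x :+ z) refl c (h w) (coeff Z w) (linExt h (remove w Z)))
... | no _ = trans (cong (c * h w +_) (linExt-collect h u Z))
       (solve 4 (λ a b y z → a :+ (y :* b :+ z) := y :* b :+ (a :+ z)) refl (c * h w) (h u) (coeff Z u) (linExt h (remove u Z)))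

-- A linear extension only sees the coefficients of the polynomial: it vanishes
-- whenever every ⟨Z | w⟩ h(w) does (induction on the length of Z, collecting words).
linExt-vanishes : ∀ h Z → (∀ w → coeff Z w * h w ≡ 0ℚ) → linExt h Z ≡ 0ℚ
linExt-vanishes h Z = bounded (length Z) Z ℕP.≤-refl
  where
  bounded : ∀ n Z → length Z ≤ n → (∀ w → coeff Z w * h w ≡ 0ℚ) → linExt h Z ≡ 0ℚ
  bounded n [] _ _ = refl
  bounded (suc n) ((c , u) ∷ Z) (s≤s len) hz = begin
    c * h u + linExt h Z
      ≡⟨ cong (c * h u +_) (linExt-collect h u Z) ⟩
    c * h u + (coeff Z u * h u + linExt h (remove u Z))
      ≡⟨ ℚP.+-assoc (c * h u) (coeff Z u * h u) _ ⟨
    (c * h u + coeff Z u * h u) + linExt h (remove u Z)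
      ≡⟨ cong₂ _+_ collected (bounded n (remove u Z) (ℕP.≤-trans (remove-length u Z) len) rest) ⟩
    0ℚ + 0ℚ
      ≡⟨ ℚP.+-identityˡ 0ℚ ⟩
    0ℚ ∎
    where
    collected : c * h u + coeff Z u * h u ≡ 0ℚ
    collected = trans (sym (ℚP.*-distribʳ-+ (h u) c (coeff Z u))) (trans (cong (_* h u) (sym (coeff-head c u Z))) (hz u))
    rest : ∀ w → coeff (remove u Z) w * h w ≡ 0ℚ
    rest w with w ≟w u
    ... | yes refl = trans (cong (_* h w) (coeff-remove-self w Z)) (ℚP.*-zeroˡ (h w))
    ... | no w≢u = trans (cong (_* h w) (trans (coeff-remove-other u Z w w≢u)
                     (sym (coeff-other c u Z w (λ e → w≢u (sym e)))))) (hz w)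

linExt-agree : ∀ f g Z → (∀ w → coeff Z w ≡ 0ℚ ⊎ f w ≡ g w) → linExt f Z ≡ linExt g Z
linExt-agree f g Z h = -≡0⇒≡ (trans (sym (linExt-- f g Z)) (linExt-vanishes (λ w → f w - g w) Z termwise))
  where
  termwise : ∀ w → coeff Z w * (f w - g w) ≡ 0ℚ
  termwise w with h w
  ... | inj₁ e = trans (cong (_* (f w - g w)) e) (ℚP.*-zeroˡ (f w - g w))
  ... | inj₂ e = trans (cong (λ z → coeff Z w * (z - g w)) e)
                       (trans (cong (coeff Z w *_) (ℚP.+-inverseʳ (g w))) (ℚP.*-zeroʳ (coeff Z w)))

linExt-resp-≈ : ∀ h P Q → P ≈ Q → linExt h P ≡ linExt h Q
linExt-resp-≈ h P Q P≈Q = -≡0⇒≡ (begin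
  linExt h P - linExt h Q            ≡⟨ cong (linExt h P +_) (linExt-neg h Q) ⟨
  linExt h P + linExt h (neg Q)      ≡⟨ linExt-++ h P (neg Q) ⟨
  linExt h (P ++ neg Q)              ≡⟨ linExt-vanishes h (P ++ neg Q) termwise ⟩
  0ℚ                                 ∎)
  where
  difference : ∀ w → coeff (P ++ neg Q) w ≡ 0ℚ
  difference w = trans (coeff-++ P (neg Q) w) (trans (cong₂ _+_ (P≈Q w) (coeff-neg Q w)) (ℚP.+-inverseʳ (coeff Q w)))
  termwise : ∀ w → coeff (P ++ neg Q) w * h w ≡ 0ℚ
  termwise w = trans (cong (_* h w) (difference w)) (ℚP.*-zeroˡ (h w))

UPoly : Set
UPoly = List ℚ

eval : UPoly → ℚ → ℚ
eval [] x = 0ℚ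
eval (c ∷ d) x = c + x * eval d x

coeffU : UPoly → ℕ → ℚ
coeffU [] s = 0ℚ
coeffU (c ∷ d) zero = c
coeffU (c ∷ d) (suc s) = coeffU d s

addU : UPoly → UPoly → UPoly
addU [] e = e
addU (a ∷ d) [] = a ∷ d
addU (a ∷ d) (b ∷ e) = (a + b) ∷ addU d e

scaleU : ℚ → UPoly → UPoly
scaleU a = map (a *_)

monomial : ℚ → ℕ → UPoly
monomial c zero = c ∷ []
monomial c (suc s) = 0ℚ ∷ monomial c s

eval-add : ∀ d e x → eval (addU d e) x ≡ eval d x + eval e x
eval-add [] e x = sym (ℚP.+-identityˡ _)
eval-add (a ∷ d) [] x = sym (ℚP.+-identityʳ _)
eval-add (a ∷ d) (b ∷ e) x = trans (cong (λ z → a + b + x * z) (eval-add d e x))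
  (solve 5 (λ a b x p q → a :+ b :+ x :* (p :+ q) := (a :+ x :* p) :+ (b :+ x :* q)) refl a b x (eval d x) (eval e x))

eval-scale : ∀ a d x → eval (scaleU a d) x ≡ a * eval d x
eval-scale a [] x = sym (ℚP.*-zeroʳ a)
eval-scale a (c ∷ d) x = trans (cong (λ z → a * c + x * z) (eval-scale a d x))
  (solve 4 (λ a c x p → a :* c :+ x :* (a :* p) := a :* (c :+ x :* p)) refl a c x (eval d x))

eval-monomial : ∀ c s x → eval (monomial c s) x ≡ c * pow x s
eval-monomial c zero x = trans (cong (c +_) (ℚP.*-zeroʳ x)) (trans (ℚP.+-identityʳ c) (sym (ℚP.*-identityʳ c)))
eval-monomial c (suc s) x = trans (cong (λ z → 0ℚ + x * z) (eval-monomial c s x))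
  (solve 3 (λ c x p → con 0ℚ :+ x :* (c :* p) := c :* (x :* p)) refl c x (pow x s))

coeffU-add : ∀ d e s → coeffU (addU d e) s ≡ coeffU d s + coeffU e s
coeffU-add [] e s = sym (ℚP.+-identityˡ _)
coeffU-add (a ∷ d) [] zero = sym (ℚP.+-identityʳ _)
coeffU-add (a ∷ d) [] (suc s) = sym (ℚP.+-identityʳ _)
coeffU-add (a ∷ d) (b ∷ e) zero = refl
coeffU-add (a ∷ d) (b ∷ e) (suc s) = coeffU-add d e s

coeffU-monomial-same : ∀ c s → coeffU (monomial c s) s ≡ c
coeffU-monomial-same c zero = refl
coeffU-monomial-same c (suc s) = coeffU-monomial-same c s

coeffU-monomial-other : ∀ c t s → t ≢ s → coeffU (monomial c t) s ≡ 0ℚ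
coeffU-monomial-other c zero zero ne = ⊥-elim (ne refl)
coeffU-monomial-other c zero (suc s) ne = refl
coeffU-monomial-other c (suc t) zero ne = refl
coeffU-monomial-other c (suc t) (suc s) ne = coeffU-monomial-other c t s (λ e → ne (cong suc e))

addU-length : ∀ d e → length e ≤ length d → length (addU d e) ≤ length d
addU-length [] [] _ = z≤n
addU-length (a ∷ d) [] _ = ℕP.≤-refl
addU-length (a ∷ d) (b ∷ e) (s≤s le) = s≤s (addU-length d e le)

-- synthetic division by (x - a): the quotient of p
quotient : ℚ → UPoly → UPoly
quotient a [] = []
quotient a (c ∷ d) = addU d (scaleU a (quotient a d))

quotient-length : ∀ a c d → length (quotient a (c ∷ d)) ≤ length d
quotient-length a c [] = z≤n
quotient-length a c (c′ ∷ d) = addU-length (c′ ∷ d) (scaleU a (quotient a (c′ ∷ d)))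
  (ℕP.≤-trans (ℕP.≤-reflexive (length-map (a *_) (quotient a (c′ ∷ d)))) (ℕP.m≤n⇒m≤1+n (quotient-length a c′ d)))

division : ∀ a p x → eval p x ≡ eval p a + (x - a) * eval (quotient a p) x
division a [] x = sym (trans (cong (0ℚ +_) (ℚP.*-zeroʳ (x - a))) (ℚP.+-identityˡ 0ℚ))
division a (c ∷ d) x = begin
  c + x * eval d x
    ≡⟨ cong (λ z → c + x * z) (division a d x) ⟩
  c + x * (eval d a + (x - a) * eval (quotient a d) x)
    ≡⟨ solve 5 (λ c x a ea eq → c :+ x :* (ea :+ (x :- a) :* eq) := (c :+ a :* ea) :+ (x :- a) :* ((ea :+ (x :- a) :* eq) :+ a :* eq))
         refl c x a (eval d a) (eval (quotient a d) x) ⟩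
  (c + a * eval d a) + (x - a) * ((eval d a + (x - a) * eval (quotient a d) x) + a * eval (quotient a d) x)
    ≡⟨ cong (λ z → (c + a * eval d a) + (x - a) * (z + a * eval (quotient a d) x)) (sym (division a d x)) ⟩
  (c + a * eval d a) + (x - a) * (eval d x + a * eval (quotient a d) x)
    ≡⟨ cong (λ z → (c + a * eval d a) + (x - a) * z)
         (trans (cong (eval d x +_) (sym (eval-scale a (quotient a d) x))) (sym (eval-add d (scaleU a (quotient a d)) x))) ⟩
  (c + a * eval d a) + (x - a) * eval (addU d (scaleU a (quotient a d))) x ∎

IsZeroU : UPoly → Set
IsZeroU d = ∀ s → coeffU d s ≡ 0ℚ

IsZeroU-eval : ∀ d → IsZeroU d → ∀ x → eval d x ≡ 0ℚ
IsZeroU-eval [] z x = refl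
IsZeroU-eval (c ∷ d) z x = trans (cong₂ (λ a b → a + x * b) (z 0) (IsZeroU-eval d (z ∘ suc) x))
  (trans (cong (0ℚ +_) (ℚP.*-zeroʳ x)) (ℚP.+-identityˡ 0ℚ))

ι-+suc-≢ : ∀ a d → ι (a ℕ.+ suc d) - ι a ≢ 0ℚ
ι-+suc-≢ a d eq = ι-suc≢0 d (trans (sym difference) eq)
  where
  difference : ι (a ℕ.+ suc d) - ι a ≡ ι (suc d)
  difference = trans (cong (_- ι a) (ι-+ a (suc d))) (solve 2 (λ x y → x :+ y :- x := y) refl (ι a) (ι (suc d)))

-- Induction on the length: p vanishes at k+1, so p = (x-(k+1)) q with q vanishing at
-- all integers > k+1; hence q = 0 and p = 0 everywhere, so its constant term is 0
-- and its tail vanishes at all positive integers.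
vanishing-polynomial : ∀ L d k → length d ≤ L → (∀ n → eval d (ι (k ℕ.+ suc n)) ≡ 0ℚ) → IsZeroU d
vanishing-polynomial L [] k _ _ s = refl
vanishing-polynomial (suc L) (c ∷ d) k (s≤s len) roots = coefficients
  where
  a : ℚ
  a = ι (k ℕ.+ 1)
  q : UPoly
  q = quotient a (c ∷ d)
  q-roots : ∀ n → eval q (ι ((k ℕ.+ 1) ℕ.+ suc n)) ≡ 0ℚ
  q-roots n = *-cancel-≢0 _ _ (ι-+suc-≢ (k ℕ.+ 1) n) (begin
    (x - a) * eval q x                          ≡⟨ ℚP.+-identityˡ _ ⟨
    0ℚ + (x - a) * eval q x                     ≡⟨ cong (_+ (x - a) * eval q x) (roots 0) ⟨
    eval (c ∷ d) a + (x - a) * eval q x         ≡⟨ division a (c ∷ d) x ⟨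
    eval (c ∷ d) x                              ≡⟨ cong (λ z → eval (c ∷ d) (ι z)) (ℕP.+-assoc k 1 (suc n)) ⟩
    eval (c ∷ d) (ι (k ℕ.+ suc (suc n)))        ≡⟨ roots (suc n) ⟩
    0ℚ                                          ∎)
    where
    x : ℚ
    x = ι ((k ℕ.+ 1) ℕ.+ suc n)
  p-zero : ∀ y → eval (c ∷ d) y ≡ 0ℚ
  p-zero y = begin
    eval (c ∷ d) y                               ≡⟨ division a (c ∷ d) y ⟩
    eval (c ∷ d) a + (y - a) * eval q y          ≡⟨ cong₂ (λ u v → u + (y - a) * v) (roots 0)
                                                      (IsZeroU-eval q (vanishing-polynomial L q (k ℕ.+ 1) (ℕP.≤-trans (quotient-length a c d) len) q-roots) y) ⟩
    0ℚ + (y - a) * 0ℚ                            ≡⟨ solve 1 (λ z → con 0ℚ :+ z :* con 0ℚ := con 0ℚ) refl (y - a) ⟩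
    0ℚ                                           ∎
  c≡0 : c ≡ 0ℚ
  c≡0 = trans (sym (trans (cong (c +_) (ℚP.*-zeroˡ (eval d 0ℚ))) (ℚP.+-identityʳ c))) (p-zero 0ℚ)
  tail-roots : ∀ n → eval d (ι (0 ℕ.+ suc n)) ≡ 0ℚ
  tail-roots n = *-cancel-≢0 (ι (suc n)) _ (ι-suc≢0 n)
    (trans (sym (ℚP.+-identityˡ _)) (trans (cong (_+ ι (suc n) * eval d (ι (suc n))) (sym c≡0)) (p-zero (ι (suc n)))))
  coefficients : IsZeroU (c ∷ d)
  coefficients zero = c≡0
  coefficients (suc s) = vanishing-polynomial L d 0 len tail-roots s

-- Polynomials in ℚ1 ⊕ ⊕ₛ ℚyₛ (no word of length ≥ 2) — the range of ⊤ — and the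
-- fact that such a polynomial is determined by its Li⁻.

Short : Poly → Set
Short P = ∀ w → 2 ≤ length w → coeff P w ≡ 0ℚ

Short-scale : ∀ c P → Short P → Short (scale c P)
Short-scale c P sP w l = begin
  coeff (scale c P) w                 ≡⟨ coeff-linExt (scale c P) w ⟩
  linExt (indicator w) (scale c P)    ≡⟨ linExt-scale (indicator w) c P ⟩
  c * linExt (indicator w) P          ≡⟨ cong (c *_) (trans (sym (coeff-linExt P w)) (sP w l)) ⟩
  c * 0ℚ                              ≡⟨ ℚP.*-zeroʳ c ⟩
  0ℚ                                  ∎

Short-sumP : ∀ n F → (∀ i → Short (F i)) → Short (sumP n F)
Short-sumP n F sF w l = trans (coeff-linExt (sumP n F) w) (trans (linExt-sumP (indicator w) n F)
  (sum-0 n (λ i _ → trans (sym (coeff-linExt (F i) w)) (sF i w l))))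

Short-lin : ∀ f L → (∀ u → Short (f u)) → Short (lin f L)
Short-lin f L sf w l = trans (coeff-linExt (lin f L) w) (trans (linExt-lin (indicator w) f L)
  (linExt-zero L (λ u → trans (sym (coeff-linExt (f u) w)) (sf u w l))))

Short-bilin : ∀ T P Q → (∀ u v → Short (T u v)) → Short (bilin T P Q)
Short-bilin T P Q sT w l = trans (coeff-linExt (bilin T P Q) w) (trans (linExt-bilin (indicator w) T P Q)
  (linExt-zero P (λ u → linExt-zero Q (λ v → trans (sym (coeff-linExt (T u v) w)) (sT u v w l)))))

letters : Poly → UPoly
letters [] = []
letters ((c , []) ∷ Z) = letters Z
letters ((c , s ∷ []) ∷ Z) = addU (monomial c s) (letters Z)
letters ((c , s ∷ t ∷ w) ∷ Z) = letters Z

coeffU-letters : ∀ Z s → coeffU (letters Z) s ≡ coeff Z (s ∷ [])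
coeffU-letters [] s = refl
coeffU-letters ((c , []) ∷ Z) s = trans (coeffU-letters Z s) (sym (coeff-other c [] Z (s ∷ []) (λ ())))
coeffU-letters ((c , t ∷ t′ ∷ w) ∷ Z) s = trans (coeffU-letters Z s) (sym (coeff-other c (t ∷ t′ ∷ w) Z (s ∷ []) (λ ())))
coeffU-letters ((c , t ∷ []) ∷ Z) s with t ℕ.≟ s
... | yes refl = trans (coeffU-add (monomial c t) (letters Z) t) (cong₂ _+_ (coeffU-monomial-same c t) (coeffU-letters Z t))
... | no t≢s = trans (coeffU-add (monomial c t) (letters Z) s)
                 (trans (cong₂ _+_ (coeffU-monomial-other c t s t≢s) (coeffU-letters Z s)) (ℚP.+-identityˡ _))

-- at N+1 ≥ 1, Li⁻_{yₛ} is (N+1)ˢ and Li⁻_1 vanishes; other words are ignored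
letterValue : ℕ → Word → ℚ
letterValue N (s ∷ []) = ι (suc N ^ s)
letterValue N _ = 0ℚ

linExt-letterValue : ∀ N Z → linExt (letterValue N) Z ≡ eval (letters Z) (ι (suc N))
linExt-letterValue N [] = refl
linExt-letterValue N ((c , []) ∷ Z) =
  trans (cong (_+ linExt (letterValue N) Z) (ℚP.*-zeroʳ c)) (trans (ℚP.+-identityˡ _) (linExt-letterValue N Z))
linExt-letterValue N ((c , s ∷ t ∷ w) ∷ Z) =
  trans (cong (_+ linExt (letterValue N) Z) (ℚP.*-zeroʳ c)) (trans (ℚP.+-identityˡ _) (linExt-letterValue N Z))
linExt-letterValue N ((c , s ∷ []) ∷ Z) = begin
  c * ι (suc N ^ s) + linExt (letterValue N) Z
    ≡⟨ cong₂ _+_ (cong (c *_) (ι-^ (suc N) s)) (linExt-letterValue N Z) ⟩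
  c * pow (ι (suc N)) s + eval (letters Z) (ι (suc N))
    ≡⟨ cong (_+ eval (letters Z) (ι (suc N))) (eval-monomial c s (ι (suc N))) ⟨
  eval (monomial c s) (ι (suc N)) + eval (letters Z) (ι (suc N))
    ≡⟨ eval-add (monomial c s) (letters Z) (ι (suc N)) ⟨
  eval (addU (monomial c s) (letters Z)) (ι (suc N)) ∎

-- the constant term of Li⁻_P is ⟨P | 1⟩, as only Li⁻_1 has one
Li⁻-at-zero : ∀ P → Li⁻ P 0 ≡ coeff P []
Li⁻-at-zero P = trans (Li⁻-linExt P 0) (trans (linExt-cong P atZero) (sym (coeff-linExt P [])))
  where
  atZero : ∀ w → Li⁻w w 0 ≡ indicator [] w
  atZero [] = refl
  atZero (s ∷ w) = refl

Li⁻-short-at-suc : ∀ Z → Short Z → ∀ N → Li⁻ Z (suc N) ≡ eval (letters Z) (ι (suc N))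
Li⁻-short-at-suc Z sZ N = trans (Li⁻-linExt Z (suc N))
  (trans (linExt-agree (λ w → Li⁻w w (suc N)) (letterValue N) Z agree) (linExt-letterValue N Z))
  where
  agree : ∀ w → coeff Z w ≡ 0ℚ ⊎ Li⁻w w (suc N) ≡ letterValue N w
  agree [] = inj₂ refl
  agree (s ∷ []) = inj₂ (ℚP.*-identityʳ _)
  agree (s ∷ t ∷ w) = inj₁ (sZ (s ∷ t ∷ w) (s≤s (s≤s z≤n)))

short-Li⁻-injective₀ : ∀ Z → Short Z → IsZero (Li⁻ Z) → ∀ w → coeff Z w ≡ 0ℚ
short-Li⁻-injective₀ Z sZ z [] = trans (sym (Li⁻-at-zero Z)) (z 0)
short-Li⁻-injective₀ Z sZ z (s ∷ t ∷ w) = sZ (s ∷ t ∷ w) (s≤s (s≤s z≤n))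
short-Li⁻-injective₀ Z sZ z (s ∷ []) = trans (sym (coeffU-letters Z s))
  (vanishing-polynomial (length (letters Z)) (letters Z) 0 ℕP.≤-refl
    (λ n → trans (sym (Li⁻-short-at-suc Z sZ n)) (z (suc n))) s)

Li⁻-++ : ∀ P Q N → Li⁻ (P ++ Q) N ≡ Li⁻ P N + Li⁻ Q N
Li⁻-++ P Q N = trans (Li⁻-linExt (P ++ Q) N) (trans (linExt-++ _ P Q) (sym (cong₂ _+_ (Li⁻-linExt P N) (Li⁻-linExt Q N))))

Li⁻-neg : ∀ P N → Li⁻ (neg P) N ≡ - Li⁻ P N
Li⁻-neg P N = trans (Li⁻-linExt (neg P) N) (trans (linExt-neg _ P) (cong -_ (sym (Li⁻-linExt P N))))

short-Li⁻-injective : ∀ X Y → Short X → Short Y → Li⁻ X ≐ Li⁻ Y → X ≈ Y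
short-Li⁻-injective X Y sX sY same w = -≡0⇒≡ (begin
  coeff X w - coeff Y w             ≡⟨ cong (coeff X w +_) (coeff-neg Y w) ⟨
  coeff X w + coeff (neg Y) w       ≡⟨ coeff-++ X (neg Y) w ⟨
  coeff (X ++ neg Y) w              ≡⟨ short-Li⁻-injective₀ (X ++ neg Y) sDiff LiDiff w ⟩
  0ℚ                                ∎)
  where
  sDiff : Short (X ++ neg Y)
  sDiff w l = trans (coeff-++ X (neg Y) w) (cong₂ _+_ (sX w l) (trans (coeff-neg Y w) (cong -_ (sY w l))))
  LiDiff : IsZero (Li⁻ (X ++ neg Y))
  LiDiff N = trans (Li⁻-++ X (neg Y) N)
    (trans (cong₂ _+_ (same N) (Li⁻-neg Y N)) (ℚP.+-inverseʳ (Li⁻ Y N)))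

⋆-linExtˡ : ∀ (F : Word → ℕ → ℚ) P g →
  ((λ n → linExt (λ w → F w n) P) ⋆ g) ≐ (λ n → linExt (λ w → (F w ⋆ g) n) P)
⋆-linExtˡ F [] g = ⋆-zeroˡ g
⋆-linExtˡ F ((c , w) ∷ P) g n = begin
  ((λ n → c * F w n + linExt (λ w → F w n) P) ⋆ g) n
    ≡⟨ ⋆-+ˡ (λ n → c * F w n) (λ n → linExt (λ w → F w n) P) g n ⟩
  ((λ n → c * F w n) ⋆ g) n + ((λ n → linExt (λ w → F w n) P) ⋆ g) n
    ≡⟨ cong₂ _+_ (⋆-*ˡ c (F w) g n) (⋆-linExtˡ F P g n) ⟩
  c * (F w ⋆ g) n + linExt (λ w → (F w ⋆ g) n) P ∎

Li⁻-bilin : ∀ T → (∀ u v → Li⁻ (T u v) ≐ (Li⁻w u ⋆ Li⁻w v)) → ∀ P Q → Li⁻ (bilin T P Q) ≐ (Li⁻ P ⋆ Li⁻ Q)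
Li⁻-bilin T spec P Q N = begin
  Li⁻ (bilin T P Q) N
    ≡⟨ Li⁻-linExt (bilin T P Q) N ⟩
  linExt (λ w → Li⁻w w N) (bilin T P Q)
    ≡⟨ linExt-bilin _ T P Q ⟩
  linExt (λ u → linExt (λ v → linExt (λ w → Li⁻w w N) (T u v)) Q) P
    ≡⟨ linExt-cong P (λ u → linExt-cong Q (λ v →
         trans (sym (Li⁻-linExt (T u v) N)) (trans (spec u v N) (⋆-comm (Li⁻w u) (Li⁻w v) N)))) ⟩
  linExt (λ u → linExt (λ v → (Li⁻w v ⋆ Li⁻w u) N) Q) P
    ≡⟨ linExt-cong P (λ u → ⋆-linExtˡ Li⁻w Q (Li⁻w u) N) ⟨
  linExt (λ u → ((λ n → linExt (λ v → Li⁻w v n) Q) ⋆ Li⁻w u) N) P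
    ≡⟨ linExt-cong P (λ u → trans (⋆-comm (λ n → linExt (λ v → Li⁻w v n) Q) (Li⁻w u) N)
         (⋆-cong {f = Li⁻w u} (λ _ → refl) (λ n → sym (Li⁻-linExt Q n)) N)) ⟩
  linExt (λ u → (Li⁻w u ⋆ Li⁻ Q) N) P
    ≡⟨ ⋆-linExtˡ Li⁻w P (Li⁻ Q) N ⟨
  ((λ n → linExt (λ u → Li⁻w u n) P) ⋆ Li⁻ Q) N
    ≡⟨ ⋆-cong {g = Li⁻ Q} (λ n → sym (Li⁻-linExt P n)) (λ _ → refl) N ⟩
  (Li⁻ P ⋆ Li⁻ Q) N ∎

H⁻w-partialSum : ∀ w N → H⁻w w N ≡ sumℚ N (Li⁻w w)
H⁻w-partialSum [] zero = refl
H⁻w-partialSum [] (suc N) = trans (H⁻w-partialSum [] N) (sym (ℚP.+-identityʳ _))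
H⁻w-partialSum (s ∷ w) zero = refl
H⁻w-partialSum (s ∷ w) (suc N) = cong (_+ ι (suc N ^ s) * H⁻w w N) (H⁻w-partialSum (s ∷ w) N)

H⁻-partialSum : ∀ P N → H⁻ P N ≡ sumℚ N (Li⁻ P)
H⁻-partialSum P N = begin
  H⁻ P N                                     ≡⟨ H⁻-linExt P N ⟩
  linExt (λ w → H⁻w w N) P                   ≡⟨ linExt-cong P (λ w → H⁻w-partialSum w N) ⟩
  linExt (λ w → sumℚ N (Li⁻w w)) P           ≡⟨ linExt-sum Li⁻w N P ⟩
  sumℚ N (λ k → linExt (λ w → Li⁻w w k) P)   ≡⟨ sum-cong N (λ k _ → sym (Li⁻-linExt P k)) ⟩
  sumℚ N (Li⁻ P)                             ∎

H⁻-zero⇔Li⁻-zero : ∀ P → IsZero (H⁻ P) ⇔ IsZero (Li⁻ P)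
H⁻-zero⇔Li⁻-zero P = mk⇔ fromH fromLi
  where
  fromH : IsZero (H⁻ P) → IsZero (Li⁻ P)
  fromH z zero = trans (sym (H⁻-partialSum P 0)) (z 0)
  fromH z (suc N) = begin
    Li⁻ P (suc N)                  ≡⟨ ℚP.+-identityˡ _ ⟨
    0ℚ + Li⁻ P (suc N)             ≡⟨ cong (_+ Li⁻ P (suc N)) (trans (sym (z N)) (H⁻-partialSum P N)) ⟩
    sumℚ (suc N) (Li⁻ P)           ≡⟨ H⁻-partialSum P (suc N) ⟨
    H⁻ P (suc N)                   ≡⟨ z (suc N) ⟩
    0ℚ                             ∎
  fromLi : IsZero (Li⁻ P) → IsZero (H⁻ P)
  fromLi z N = trans (H⁻-partialSum P N) (sum-0 N (λ k _ → z k))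

-- prefixing y₀ multiplies Li⁻ by Li⁻_{y₀} = z/(1-z): Li⁻_{y₀w}(N+1) = H⁻_w(N)
Li⁻-y₀ : ∀ w → Li⁻w (0 ∷ w) ≐ (Li⁻w (0 ∷ []) ⋆ Li⁻w w)
Li⁻-y₀ w zero = sym (ℚP.*-zeroˡ (Li⁻w w 0))
Li⁻-y₀ w (suc N) = begin
  1ℚ * H⁻w w N                                   ≡⟨ ℚP.*-identityˡ _ ⟩
  H⁻w w N                                        ≡⟨ H⁻w-partialSum w N ⟩
  sumℚ N (Li⁻w w)                                ≡⟨ sum-reverse N (Li⁻w w) ⟩
  sumℚ N (λ k → Li⁻w w (N ∸ k))                  ≡⟨ sum-cong N (λ k _ → sym (ℚP.*-identityˡ _)) ⟩
  sumℚ N (λ k → Li⁻w y₀ (suc k) * Li⁻w w (N ∸ k)) ≡⟨ ℚP.+-identityˡ _ ⟨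
  0ℚ + sumℚ N (λ k → Li⁻w y₀ (suc k) * Li⁻w w (N ∸ k))
    ≡⟨ cong (_+ sumℚ N (λ k → Li⁻w y₀ (suc k) * Li⁻w w (N ∸ k))) (ℚP.*-zeroˡ (Li⁻w w (suc N))) ⟨
  Li⁻w y₀ 0 * Li⁻w w (suc N) + sumℚ N (λ k → Li⁻w y₀ (suc k) * Li⁻w w (N ∸ k))
    ≡⟨ sum-peel N (λ k → Li⁻w y₀ k * Li⁻w w (suc N ∸ k)) ⟨
  (Li⁻w y₀ ⋆ Li⁻w w) (suc N) ∎
  where
  y₀ : Word
  y₀ = 0 ∷ []

Li⁻-word : ∀ w → Li⁻ (word w) ≐ Li⁻w w
Li⁻-word w N = trans (ℚP.+-identityʳ _) (ℚP.*-identityˡ _)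

Li⁻-empty : Li⁻w [] ≐ δ
Li⁻-empty zero = refl
Li⁻-empty (suc n) = refl

H⁻-++ : ∀ P Q N → H⁻ (P ++ Q) N ≡ H⁻ P N + H⁻ Q N
H⁻-++ P Q N = trans (H⁻-linExt (P ++ Q) N) (trans (linExt-++ _ P Q) (sym (cong₂ _+_ (H⁻-linExt P N) (H⁻-linExt Q N))))

H⁻-word : ∀ w N → H⁻ (word w) N ≡ H⁻w w N
H⁻-word w N = trans (ℚP.+-identityʳ _) (ℚP.*-identityˡ _)

H⁻-prefix : ∀ j P N → H⁻ (prefix j P) (suc N) ≡ H⁻ (prefix j P) N + ι (suc N ^ j) * H⁻ P N
H⁻-prefix j P N = begin
  H⁻ (prefix j P) (suc N)
    ≡⟨ trans (H⁻-linExt (prefix j P) (suc N)) (linExt-prefix _ j P) ⟩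
  linExt (λ w → H⁻w (j ∷ w) N + ι (suc N ^ j) * H⁻w w N) P
    ≡⟨ linExt-+* (λ w → H⁻w (j ∷ w) N) (λ w → H⁻w w N) (ι (suc N ^ j)) P ⟩
  linExt (λ w → H⁻w (j ∷ w) N) P + ι (suc N ^ j) * linExt (λ w → H⁻w w N) P
    ≡⟨ cong₂ (λ x y → x + ι (suc N ^ j) * y) (sym (trans (H⁻-linExt (prefix j P) N) (linExt-prefix _ j P))) (sym (H⁻-linExt P N)) ⟩
  H⁻ (prefix j P) N + ι (suc N ^ j) * H⁻ P N ∎

H⁻-prefix-zero : ∀ j P → H⁻ (prefix j P) 0 ≡ 0ℚ
H⁻-prefix-zero j P = trans (H⁻-linExt (prefix j P) 0) (trans (linExt-prefix _ j P) (linExt-zero P (λ _ → refl)))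

H⁻-stuffle-step : ∀ i u j v N →
  H⁻ (stw (i ∷ u) (j ∷ v)) (suc N) ≡
    H⁻ (stw (i ∷ u) (j ∷ v)) N + ι (suc N ^ j) * H⁻ (stw (i ∷ u) v) N
      + ι (suc N ^ i) * H⁻ (stw u (j ∷ v)) N + (ι (suc N ^ i) * ι (suc N ^ j)) * H⁻ (stw u v) N
H⁻-stuffle-step i u j v N = begin
  H⁻ (Tⱼ ++ (Tᵢ ++ Tᵢⱼ)) (suc N)
    ≡⟨ trans (H⁻-++ Tⱼ (Tᵢ ++ Tᵢⱼ) (suc N)) (cong (H⁻ Tⱼ (suc N) +_) (H⁻-++ Tᵢ Tᵢⱼ (suc N))) ⟩
  H⁻ Tⱼ (suc N) + (H⁻ Tᵢ (suc N) + H⁻ Tᵢⱼ (suc N))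
    ≡⟨ cong₂ _+_ (H⁻-prefix j (stw (i ∷ u) v) N) (cong₂ _+_ (H⁻-prefix i (stw u (j ∷ v)) N) (H⁻-prefix (i ℕ.+ j) (stw u v) N)) ⟩
  (H⁻ Tⱼ N + aj * x) + ((H⁻ Tᵢ N + ai * y) + (H⁻ Tᵢⱼ N + ι (suc N ^ (i ℕ.+ j)) * z))
    ≡⟨ cong (λ t → (H⁻ Tⱼ N + aj * x) + ((H⁻ Tᵢ N + ai * y) + (H⁻ Tᵢⱼ N + t * z)))
         (trans (cong ι (ℕP.^-distribˡ-+-* (suc N) i j)) (ι-* (suc N ^ i) (suc N ^ j))) ⟩
  (H⁻ Tⱼ N + aj * x) + ((H⁻ Tᵢ N + ai * y) + (H⁻ Tᵢⱼ N + (ai * aj) * z))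
    ≡⟨ solve 9 (λ a b c aj ai x y z t → (a :+ aj :* x) :+ ((b :+ ai :* y) :+ (c :+ t :* z))
            := (a :+ (b :+ c)) :+ aj :* x :+ ai :* y :+ t :* z) refl
         (H⁻ Tⱼ N) (H⁻ Tᵢ N) (H⁻ Tᵢⱼ N) aj ai x y z (ai * aj) ⟩
  (H⁻ Tⱼ N + (H⁻ Tᵢ N + H⁻ Tᵢⱼ N)) + aj * x + ai * y + (ai * aj) * z
    ≡⟨ cong (λ t → t + aj * x + ai * y + (ai * aj) * z)
         (sym (trans (H⁻-++ Tⱼ (Tᵢ ++ Tᵢⱼ) N) (cong (H⁻ Tⱼ N +_) (H⁻-++ Tᵢ Tᵢⱼ N)))) ⟩
  H⁻ (Tⱼ ++ (Tᵢ ++ Tᵢⱼ)) N + aj * x + ai * y + (ai * aj) * z ∎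
  where
  Tⱼ Tᵢ Tᵢⱼ : Poly
  Tⱼ = prefix j (stw (i ∷ u) v)
  Tᵢ = prefix i (stw u (j ∷ v))
  Tᵢⱼ = prefix (i ℕ.+ j) (stw u v)
  ai aj x y z : ℚ
  ai = ι (suc N ^ i)
  aj = ι (suc N ^ j)
  x = H⁻ (stw (i ∷ u) v) N
  y = H⁻ (stw u (j ∷ v)) N
  z = H⁻ (stw u v) N

H⁻-stuffle-words : ∀ N u v → H⁻ (stw u v) N ≡ H⁻w u N * H⁻w v N
H⁻-stuffle-words N [] v = trans (H⁻-word v N) (sym (ℚP.*-identityˡ _))
H⁻-stuffle-words N (i ∷ u) [] = trans (H⁻-word (i ∷ u) N) (sym (ℚP.*-identityʳ _))
H⁻-stuffle-words zero (i ∷ u) (j ∷ v) = begin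
  H⁻ (prefix j (stw (i ∷ u) v) ++ (prefix i (stw u (j ∷ v)) ++ prefix (i ℕ.+ j) (stw u v))) 0
    ≡⟨ trans (H⁻-++ (prefix j (stw (i ∷ u) v)) _ 0) (cong (H⁻ (prefix j (stw (i ∷ u) v)) 0 +_) (H⁻-++ (prefix i (stw u (j ∷ v))) _ 0)) ⟩
  H⁻ (prefix j (stw (i ∷ u) v)) 0 + (H⁻ (prefix i (stw u (j ∷ v))) 0 + H⁻ (prefix (i ℕ.+ j) (stw u v)) 0)
    ≡⟨ cong₂ _+_ (H⁻-prefix-zero j (stw (i ∷ u) v)) (cong₂ _+_ (H⁻-prefix-zero i (stw u (j ∷ v))) (H⁻-prefix-zero (i ℕ.+ j) (stw u v))) ⟩
  0ℚ + (0ℚ + 0ℚ)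
    ≡⟨ solve 0 (con 0ℚ :+ (con 0ℚ :+ con 0ℚ) := con 0ℚ :* con 0ℚ) refl ⟩
  0ℚ * 0ℚ ∎
H⁻-stuffle-words (suc N) (i ∷ u) (j ∷ v) = begin
  H⁻ (stw (i ∷ u) (j ∷ v)) (suc N)
    ≡⟨ H⁻-stuffle-step i u j v N ⟩
  H⁻ (stw (i ∷ u) (j ∷ v)) N + aj * H⁻ (stw (i ∷ u) v) N + ai * H⁻ (stw u (j ∷ v)) N + (ai * aj) * H⁻ (stw u v) N
    ≡⟨ cong₂ _+_ (cong₂ _+_ (cong₂ (λ p q → p + aj * q) (H⁻-stuffle-words N (i ∷ u) (j ∷ v)) (H⁻-stuffle-words N (i ∷ u) v))
                            (cong (ai *_) (H⁻-stuffle-words N u (j ∷ v))))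
                 (cong ((ai * aj) *_) (H⁻-stuffle-words N u v)) ⟩
  X * Y + aj * (X * Hv) + ai * (Hu * Y) + (ai * aj) * (Hu * Hv)
    ≡⟨ solve 6 (λ x y aj ai hu hv → x :* y :+ aj :* (x :* hv) :+ ai :* (hu :* y) :+ (ai :* aj) :* (hu :* hv)
          := (x :+ ai :* hu) :* (y :+ aj :* hv)) refl X Y aj ai Hu Hv ⟩
  (X + ai * Hu) * (Y + aj * Hv) ∎
  where
  ai aj X Y Hu Hv : ℚ
  ai = ι (suc N ^ i)
  aj = ι (suc N ^ j)
  X = H⁻w (i ∷ u) N
  Y = H⁻w (j ∷ v) N
  Hu = H⁻w u N
  Hv = H⁻w v N

H⁻-stuffle : ∀ P Q N → H⁻ (P ✱ Q) N ≡ H⁻ P N * H⁻ Q N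
H⁻-stuffle P Q N = begin
  H⁻ (bilin stw P Q) N
    ≡⟨ trans (H⁻-linExt (bilin stw P Q) N) (linExt-bilin _ stw P Q) ⟩
  linExt (λ u → linExt (λ v → linExt Hₙ (stw u v)) Q) P
    ≡⟨ linExt-cong P (λ u → linExt-cong Q (λ v → trans (sym (H⁻-linExt (stw u v) N)) (H⁻-stuffle-words N u v))) ⟩
  linExt (λ u → linExt (λ v → Hₙ u * Hₙ v) Q) P
    ≡⟨ linExt-cong P (λ u → linExt-* (Hₙ u) Hₙ Q) ⟩
  linExt (λ u → Hₙ u * linExt Hₙ Q) P
    ≡⟨ linExt-cong P (λ u → ℚP.*-comm (Hₙ u) (linExt Hₙ Q)) ⟩
  linExt (λ u → linExt Hₙ Q * Hₙ u) P
    ≡⟨ linExt-* (linExt Hₙ Q) Hₙ P ⟩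
  linExt Hₙ Q * linExt Hₙ P
    ≡⟨ ℚP.*-comm (linExt Hₙ Q) (linExt Hₙ P) ⟩
  linExt Hₙ P * linExt Hₙ Q
    ≡⟨ cong₂ _*_ (H⁻-linExt P N) (H⁻-linExt Q N) ⟨
  H⁻ P N * H⁻ Q N ∎
  where
  Hₙ : Word → ℚ
  Hₙ w = H⁻w w N

binomial : ∀ n x y → sumℚ n (λ i → ι (n C i) * (pow y i * pow x (n ∸ i))) ≡ pow (x + y) n
binomial zero x y = solve 0 (con 1ℚ :* (con 1ℚ :* con 1ℚ) := con 1ℚ) refl
binomial (suc n) x y = begin
  sumℚ (suc n) (λ i → ι (suc n C i) * (pow y i * pow x (suc n ∸ i)))
    ≡⟨ sum-peel n _ ⟩
  D 0 + sumℚ n (λ i → ι (suc n C suc i) * (pow y (suc i) * pow x (n ∸ i)))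
    ≡⟨ cong (D 0 +_) (trans (sum-cong n (λ i _ → pascal i)) (sum-+ n _ _)) ⟩
  D 0 + (sumℚ n (λ i → y * E i) + sumℚ n (D ∘ suc))
    ≡⟨ cong (λ z → D 0 + (z + sumℚ n (D ∘ suc))) (sum-*ˡ n y E) ⟩
  D 0 + (y * sumℚ n E + sumℚ n (D ∘ suc))
    ≡⟨ solve 3 (λ a b c → a :+ (b :+ c) := b :+ (a :+ c)) refl (D 0) (y * sumℚ n E) (sumℚ n (D ∘ suc)) ⟩
  y * sumℚ n E + (D 0 + sumℚ n (D ∘ suc))
    ≡⟨ cong (y * sumℚ n E +_) (trans (sym (sum-peel n D)) (trans (cong (sumℚ n D +_) D-last) (ℚP.+-identityʳ _))) ⟩
  y * sumℚ n E + sumℚ n D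
    ≡⟨ cong (y * sumℚ n E +_) (trans (sum-cong n D≡xE) (sum-*ˡ n x E)) ⟩
  y * sumℚ n E + x * sumℚ n E
    ≡⟨ cong (λ z → y * z + x * z) (binomial n x y) ⟩
  y * pow (x + y) n + x * pow (x + y) n
    ≡⟨ solve 3 (λ x y p → y :* p :+ x :* p := (x :+ y) :* p) refl x y (pow (x + y) n) ⟩
  pow (x + y) (suc n) ∎
  where
  E D : ℕ → ℚ
  E i = ι (n C i) * (pow y i * pow x (n ∸ i))
  D i = ι (n C i) * (pow y i * pow x (suc n ∸ i))
  pascal : ∀ i → ι (suc n C suc i) * (pow y (suc i) * pow x (n ∸ i)) ≡ y * E i + D (suc i)
  pascal i = trans (cong (λ z → ι z * (pow y (suc i) * pow x (n ∸ i))) (sym (nCk+nC[k+1]≡[n+1]C[k+1] n i)))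
    (trans (cong (_* (pow y (suc i) * pow x (n ∸ i))) (ι-+ (n C i) (n C suc i)))
      (solve 5 (λ a b y p q → (a :+ b) :* ((y :* p) :* q) := y :* (a :* (p :* q)) :+ b :* ((y :* p) :* q)) refl
        (ι (n C i)) (ι (n C suc i)) y (pow y i) (pow x (n ∸ i))))
  D-last : D (suc n) ≡ 0ℚ
  D-last = trans (cong (λ z → ι z * (pow y (suc n) * pow x (suc n ∸ suc n))) (k>n⇒nCk≡0 (ℕP.n<1+n n)))
    (ℚP.*-zeroˡ (pow y (suc n) * pow x (suc n ∸ suc n)))
  D≡xE : ∀ i → i ≤ n → D i ≡ x * E i
  D≡xE i i≤n = trans (cong (λ z → ι (n C i) * (pow y i * pow x z)) (ℕP.+-∸-assoc 1 i≤n))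
    (solve 4 (λ c p x q → c :* (p :* (x :* q)) := x :* (c :* (p :* q))) refl (ι (n C i)) (pow y i) x (pow x (n ∸ i)))

Li⁻-letter-⋆ : ∀ i g M → (Li⁻w (i ∷ []) ⋆ g) (suc M) ≡ sumℚ M (λ k → Li⁻w (i ∷ []) (suc (M ∸ k)) * g k)
Li⁻-letter-⋆ i g M = begin
  (Li⁻w (i ∷ []) ⋆ g) (suc M)
    ≡⟨ sum-peel M (λ j → Li⁻w (i ∷ []) j * g (suc M ∸ j)) ⟩
  0ℚ * g (suc M) + sumℚ M (λ j → Li⁻w (i ∷ []) (suc j) * g (M ∸ j))
    ≡⟨ trans (cong (_+ sumℚ M (λ j → Li⁻w (i ∷ []) (suc j) * g (M ∸ j))) (ℚP.*-zeroˡ (g (suc M)))) (ℚP.+-identityˡ _) ⟩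
  sumℚ M (λ j → Li⁻w (i ∷ []) (suc j) * g (M ∸ j))
    ≡⟨ sum-reverse M (λ j → Li⁻w (i ∷ []) (suc j) * g (M ∸ j)) ⟩
  sumℚ M (λ k → Li⁻w (i ∷ []) (suc (M ∸ k)) * g (M ∸ (M ∸ k)))
    ≡⟨ sum-cong M (λ k k≤M → cong (λ z → Li⁻w (i ∷ []) (suc (M ∸ k)) * g z) (ℕP.m∸[m∸n]≡n k≤M)) ⟩
  sumℚ M (λ k → Li⁻w (i ∷ []) (suc (M ∸ k)) * g k) ∎

-- one coefficient of the identity of part (3): with n₂ = k+1 ≤ M and n₁ = M+1,
-- Σᵢ (s₁ choose i) (n₁-n₂)ⁱ n₂^{s₁-i} n₂^{s₂} H⁻_rest = n₁^{s₁} n₂^{s₂} H⁻_rest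
binomial-coefficient : ∀ s₁ s₂ rest M k → k ≤ M →
  sumℚ s₁ (λ i → ι (s₁ C i) * (Li⁻w (i ∷ []) (suc (M ∸ k)) * Li⁻w ((s₁ ∸ i) ℕ.+ s₂ ∷ rest) k))
    ≡ ι (suc M ^ s₁) * Li⁻w (s₂ ∷ rest) k
binomial-coefficient s₁ s₂ rest M zero _ = trans
  (sum-0 s₁ (λ i _ → trans (cong (ι (s₁ C i) *_) (ℚP.*-zeroʳ (Li⁻w (i ∷ []) (suc M)))) (ℚP.*-zeroʳ (ι (s₁ C i)))))
  (sym (ℚP.*-zeroʳ (ι (suc M ^ s₁))))
binomial-coefficient s₁ s₂ rest M (suc k) k<M = begin
  sumℚ s₁ (λ i → ι (s₁ C i) * (Li⁻w (i ∷ []) (suc (M ∸ suc k)) * Li⁻w ((s₁ ∸ i) ℕ.+ s₂ ∷ rest) (suc k)))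
    ≡⟨ sum-cong s₁ (λ i _ → term i) ⟩
  sumℚ s₁ (λ i → (ι (s₁ C i) * (pow b i * pow a (s₁ ∸ i))) * (pow a s₂ * H))
    ≡⟨ sum-*ʳ s₁ (pow a s₂ * H) (λ i → ι (s₁ C i) * (pow b i * pow a (s₁ ∸ i))) ⟩
  sumℚ s₁ (λ i → ι (s₁ C i) * (pow b i * pow a (s₁ ∸ i))) * (pow a s₂ * H)
    ≡⟨ cong (_* (pow a s₂ * H)) (binomial s₁ a b) ⟩
  pow (a + b) s₁ * (pow a s₂ * H)
    ≡⟨ cong₂ (λ x y → x * (y * H)) (trans (cong (λ z → pow z s₁) a+b) (sym (ι-^ (suc M) s₁))) (sym (ι-^ (suc k) s₂)) ⟩
  ι (suc M ^ s₁) * (ι (suc k ^ s₂) * H) ∎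
  where
  a b H : ℚ
  a = ι (suc k)
  b = ι (suc (M ∸ suc k))
  H = H⁻w rest k
  a+b : a + b ≡ ι (suc M)
  a+b = trans (sym (ι-+ (suc k) (suc (M ∸ suc k))))
    (cong ι (trans (ℕP.+-suc (suc k) (M ∸ suc k)) (cong suc (ℕP.m+[n∸m]≡n k<M))))
  term : ∀ i → ι (s₁ C i) * (Li⁻w (i ∷ []) (suc (M ∸ suc k)) * Li⁻w ((s₁ ∸ i) ℕ.+ s₂ ∷ rest) (suc k))
             ≡ (ι (s₁ C i) * (pow b i * pow a (s₁ ∸ i))) * (pow a s₂ * H)
  term i = begin
    ι (s₁ C i) * ((ι (suc (M ∸ suc k) ^ i) * 1ℚ) * (ι (suc k ^ ((s₁ ∸ i) ℕ.+ s₂)) * H))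
      ≡⟨ cong₂ (λ p q → ι (s₁ C i) * ((p * 1ℚ) * (q * H))) (ι-^ (suc (M ∸ suc k)) i)
           (trans (cong ι (ℕP.^-distribˡ-+-* (suc k) (s₁ ∸ i) s₂))
             (trans (ι-* (suc k ^ (s₁ ∸ i)) (suc k ^ s₂)) (cong₂ _*_ (ι-^ (suc k) (s₁ ∸ i)) (ι-^ (suc k) s₂)))) ⟩
    ι (s₁ C i) * ((pow b i * 1ℚ) * ((pow a (s₁ ∸ i) * pow a s₂) * H))
      ≡⟨ solve 5 (λ c p q r h → c :* ((p :* con 1ℚ) :* ((q :* r) :* h)) := (c :* (p :* q)) :* (r :* h)) refl
           (ι (s₁ C i)) (pow b i) (pow a (s₁ ∸ i)) (pow a s₂) H ⟩
    (ι (s₁ C i) * (pow b i * pow a (s₁ ∸ i))) * (pow a s₂ * H) ∎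

-- the series identity behind part (3):
-- Σᵢ (s₁ choose i) Li⁻_{yᵢ} Li⁻_{y_{s₁-i+s₂} rest} = Li⁻_{y_{s₁} y_{s₂} rest}
Li⁻-two-letters : ∀ s₁ s₂ rest →
  (λ N → sumℚ s₁ (λ i → ι (s₁ C i) * (Li⁻w (i ∷ []) ⋆ Li⁻w ((s₁ ∸ i) ℕ.+ s₂ ∷ rest)) N)) ≐ Li⁻w (s₁ ∷ s₂ ∷ rest)
Li⁻-two-letters s₁ s₂ rest zero =
  sum-0 s₁ (λ i _ → trans (cong (ι (s₁ C i) *_) (ℚP.*-zeroˡ (Li⁻w ((s₁ ∸ i) ℕ.+ s₂ ∷ rest) 0))) (ℚP.*-zeroʳ (ι (s₁ C i))))
Li⁻-two-letters s₁ s₂ rest (suc M) = begin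
  sumℚ s₁ (λ i → ι (s₁ C i) * (Li⁻w (i ∷ []) ⋆ L i) (suc M))
    ≡⟨ sum-cong s₁ (λ i _ → cong (ι (s₁ C i) *_) (Li⁻-letter-⋆ i (L i) M)) ⟩
  sumℚ s₁ (λ i → ι (s₁ C i) * sumℚ M (G i))
    ≡⟨ sum-cong s₁ (λ i _ → sym (sum-*ˡ M (ι (s₁ C i)) (G i))) ⟩
  sumℚ s₁ (λ i → sumℚ M (λ k → ι (s₁ C i) * G i k))
    ≡⟨ sum-swap s₁ M (λ i k → ι (s₁ C i) * G i k) ⟩
  sumℚ M (λ k → sumℚ s₁ (λ i → ι (s₁ C i) * G i k))
    ≡⟨ sum-cong M (binomial-coefficient s₁ s₂ rest M) ⟩
  sumℚ M (λ k → ι (suc M ^ s₁) * Li⁻w (s₂ ∷ rest) k)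
    ≡⟨ sum-*ˡ M (ι (suc M ^ s₁)) (Li⁻w (s₂ ∷ rest)) ⟩
  ι (suc M ^ s₁) * sumℚ M (Li⁻w (s₂ ∷ rest))
    ≡⟨ cong (ι (suc M ^ s₁) *_) (H⁻w-partialSum (s₂ ∷ rest) M) ⟨
  ι (suc M ^ s₁) * H⁻w (s₂ ∷ rest) M ∎
  where
  L : ℕ → ℕ → ℚ
  L i = Li⁻w ((s₁ ∸ i) ℕ.+ s₂ ∷ rest)
  G : ℕ → ℕ → ℚ
  G i k = Li⁻w (i ∷ []) (suc (M ∸ k)) * L i k

-- Consequences of the defining property of ⊤ (TopSpec): u ⊤ v lies in
-- ℚ1 ⊕ ⊕ₛ ℚyₛ and Li⁻_{u⊤v} = Li⁻_u Li⁻_v.  By injectivity of Li⁻ on that space,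
-- every identity between such elements follows from the identity of their Li⁻.

module TopConsequences (top : Word → Word → Poly) (spec : TopSpec top) where

  top-short : ∀ u v → Short (top u v)
  top-short u v = proj₁ (spec u v)

  Li⁻-top : ∀ u v → Li⁻ (top u v) ≐ (Li⁻w u ⋆ Li⁻w v)
  Li⁻-top u v = proj₂ (spec u v)

  Li⁻-top-bilin : ∀ P Q → Li⁻ (bilin top P Q) ≐ (Li⁻ P ⋆ Li⁻ Q)
  Li⁻-top-bilin = Li⁻-bilin top Li⁻-top

  Li⁻-top-unit : ∀ w → Li⁻ (top w []) ≐ Li⁻w w
  Li⁻-top-unit w N = trans (Li⁻-top w [] N) (trans (⋆-cong {f = Li⁻w w} (λ _ → refl) Li⁻-empty N) (⋆-identityʳ (Li⁻w w) N))

  -- Part (2): ⟨u ⊤ v | 1⟩ = Li⁻_u(0) Li⁻_v(0), which is nonzero iff u = v = 1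
  unit-coefficient : ∀ u v → coeff (top u v) [] ≡ Li⁻w u 0 * Li⁻w v 0
  unit-coefficient u v = trans (sym (Li⁻-at-zero (top u v))) (Li⁻-top u v 0)

  unit-coefficient≢0 : ∀ u v → (¬ (coeff (top u v) [] ≡ 0ℚ)) ⇔ ((u ≡ []) × (v ≡ []))
  unit-coefficient≢0 u v = mk⇔ (λ ne → empty u v (λ e → ne (trans (unit-coefficient u v) e))) nonzero
    where
    empty : ∀ u v → ¬ (Li⁻w u 0 * Li⁻w v 0 ≡ 0ℚ) → (u ≡ []) × (v ≡ [])
    empty [] [] _ = refl , refl
    empty (s ∷ u) v ne = ⊥-elim (ne (ℚP.*-zeroˡ (Li⁻w v 0)))
    empty [] (t ∷ v) ne = ⊥-elim (ne (ℚP.*-zeroʳ 1ℚ))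
    nonzero : (u ≡ []) × (v ≡ []) → ¬ (coeff (top u v) [] ≡ 0ℚ)
    nonzero (refl , refl) e = ℚP.1≢0 (trans (sym (unit-coefficient [] [])) e)

  -- Part (3), first identities: all three sides have Li⁻ equal to Li⁻_{y₀} Li⁻_u Li⁻_v
  y₀-rules : ∀ u v → (top (0 ∷ u) v ≈ top u (0 ∷ v)) × (top u (0 ∷ v) ≈ bilin top (word (0 ∷ [])) (top u v))
  y₀-rules u v =
    short-Li⁻-injective (top (0 ∷ u) v) (top u (0 ∷ v)) (top-short (0 ∷ u) v) (top-short u (0 ∷ v))
      (λ N → trans (left N) (sym (right N))) ,
    short-Li⁻-injective (top u (0 ∷ v)) (bilin top (word (0 ∷ [])) (top u v)) (top-short u (0 ∷ v))
      (Short-bilin top (word (0 ∷ [])) (top u v) top-short) (λ N → trans (right N) (sym (outer N)))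
    where
    Lu Lv Ly₀ : ℕ → ℚ
    Lu = Li⁻w u
    Lv = Li⁻w v
    Ly₀ = Li⁻w (0 ∷ [])
    left : Li⁻ (top (0 ∷ u) v) ≐ (Ly₀ ⋆ (Lu ⋆ Lv))
    left N = trans (Li⁻-top (0 ∷ u) v N) (trans (⋆-cong {g = Lv} (Li⁻-y₀ u) (λ _ → refl) N) (⋆-assoc Ly₀ Lu Lv N))
    right : Li⁻ (top u (0 ∷ v)) ≐ (Ly₀ ⋆ (Lu ⋆ Lv))
    right N = begin
      Li⁻ (top u (0 ∷ v)) N     ≡⟨ Li⁻-top u (0 ∷ v) N ⟩
      (Lu ⋆ Li⁻w (0 ∷ v)) N     ≡⟨ ⋆-cong {f = Lu} (λ _ → refl) (λ n → trans (Li⁻-y₀ v n) (⋆-comm Ly₀ Lv n)) N ⟩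
      (Lu ⋆ (Lv ⋆ Ly₀)) N       ≡⟨ ⋆-assoc Lu Lv Ly₀ N ⟨
      ((Lu ⋆ Lv) ⋆ Ly₀) N       ≡⟨ ⋆-comm (Lu ⋆ Lv) Ly₀ N ⟩
      (Ly₀ ⋆ (Lu ⋆ Lv)) N       ∎
    outer : Li⁻ (bilin top (word (0 ∷ [])) (top u v)) ≐ (Ly₀ ⋆ (Lu ⋆ Lv))
    outer N = trans (Li⁻-top-bilin (word (0 ∷ [])) (top u v) N) (⋆-cong (Li⁻-word (0 ∷ [])) (Li⁻-top u v) N)

  top-unit-expansion : ∀ s₁ s₂ rest →
    top (s₁ ∷ s₂ ∷ rest) [] ≈ sumP s₁ (λ i → scale (ι (s₁ C i)) (top (i ∷ []) ((s₁ ∸ i) ℕ.+ s₂ ∷ rest)))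
  top-unit-expansion s₁ s₂ rest =
    short-Li⁻-injective (top (s₁ ∷ s₂ ∷ rest) []) (sumP s₁ F) (top-short (s₁ ∷ s₂ ∷ rest) [])
      (Short-sumP s₁ F (λ i → Short-scale (ι (s₁ C i)) (T i) (top-short (i ∷ []) ((s₁ ∸ i) ℕ.+ s₂ ∷ rest)))) same
    where
    T F : ℕ → Poly
    T i = top (i ∷ []) ((s₁ ∸ i) ℕ.+ s₂ ∷ rest)
    F i = scale (ι (s₁ C i)) (T i)
    Li⁻-F : ∀ i N → Li⁻ (F i) N ≡ ι (s₁ C i) * (Li⁻w (i ∷ []) ⋆ Li⁻w ((s₁ ∸ i) ℕ.+ s₂ ∷ rest)) N
    Li⁻-F i N = trans (Li⁻-linExt (F i) N) (trans (linExt-scale _ (ι (s₁ C i)) (T i))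
      (cong (ι (s₁ C i) *_) (trans (sym (Li⁻-linExt (T i) N)) (Li⁻-top (i ∷ []) ((s₁ ∸ i) ℕ.+ s₂ ∷ rest) N))))
    same : Li⁻ (top (s₁ ∷ s₂ ∷ rest) []) ≐ Li⁻ (sumP s₁ F)
    same N = begin
      Li⁻ (top (s₁ ∷ s₂ ∷ rest) []) N
        ≡⟨ Li⁻-top-unit (s₁ ∷ s₂ ∷ rest) N ⟩
      Li⁻w (s₁ ∷ s₂ ∷ rest) N
        ≡⟨ Li⁻-two-letters s₁ s₂ rest N ⟨
      sumℚ s₁ (λ i → ι (s₁ C i) * (Li⁻w (i ∷ []) ⋆ Li⁻w ((s₁ ∸ i) ℕ.+ s₂ ∷ rest)) N)
        ≡⟨ sum-cong s₁ (λ i _ → sym (Li⁻-F i N)) ⟩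
      sumℚ s₁ (λ i → Li⁻ (F i) N)
        ≡⟨ trans (sum-cong s₁ (λ i _ → Li⁻-linExt (F i) N)) (sym (linExt-sumP _ s₁ F)) ⟩
      linExt (λ w → Li⁻w w N) (sumP s₁ F)
        ≡⟨ Li⁻-linExt (sumP s₁ F) N ⟨
      Li⁻ (sumP s₁ F) N ∎

  unitDefect : Word → Poly
  unitDefect w = word w ++ neg (top w [])

  linExt-unitDefect : ∀ f w → linExt f (unitDefect w) ≡ f w - linExt f (top w [])
  linExt-unitDefect f w = trans (linExt-++ f (word w) (neg (top w []))) (cong₂ _+_ (linExt-word f w) (linExt-neg f (top w [])))

  H⁻-unitDefect : ∀ w N → linExt (λ u → H⁻w u N) (unitDefect w) ≡ 0ℚ
  H⁻-unitDefect w N = begin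
    linExt Hₙ (unitDefect w)               ≡⟨ linExt-unitDefect Hₙ w ⟩
    H⁻w w N - linExt Hₙ (top w [])         ≡⟨ cong (λ t → H⁻w w N - t) (sym (H⁻-linExt (top w []) N)) ⟩
    H⁻w w N - H⁻ (top w []) N              ≡⟨ cong (λ t → H⁻w w N - t) (trans (H⁻-partialSum (top w []) N)
                                                 (trans (sum-cong N (λ k _ → Li⁻-top-unit w k)) (sym (H⁻w-partialSum w N)))) ⟩
    H⁻w w N - H⁻w w N                      ≡⟨ ℚP.+-inverseʳ (H⁻w w N) ⟩
    0ℚ                                     ∎
    where
    Hₙ : Word → ℚ
    Hₙ u = H⁻w u N

  -- Σ ⟨P|w⟩ w ⊤ 1 is a short polynomial with the same Li⁻ as P
  unitProjection : Poly → Poly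
  unitProjection P = lin (λ w → top w []) P

  Li⁻-unitProjection : ∀ P → Li⁻ (unitProjection P) ≐ Li⁻ P
  Li⁻-unitProjection P N = begin
    Li⁻ (unitProjection P) N
      ≡⟨ trans (Li⁻-linExt (unitProjection P) N) (linExt-lin _ (λ w → top w []) P) ⟩
    linExt (λ u → linExt (λ w → Li⁻w w N) (top u [])) P
      ≡⟨ linExt-cong P (λ u → trans (sym (Li⁻-linExt (top u []) N)) (Li⁻-top-unit u N)) ⟩
    linExt (λ u → Li⁻w u N) P
      ≡⟨ Li⁻-linExt P N ⟨
    Li⁻ P N ∎

  -- P = Σ ⟨P|w⟩ (w - w ⊤ 1) + unitProjection P, and the last term vanishes on the kernel
  kernel-decomposition : ∀ P → IsZero (H⁻ P) → P ≈ lin unitDefect P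
  kernel-decomposition P z w = sym (begin
    coeff (lin unitDefect P) w
      ≡⟨ trans (coeff-linExt (lin unitDefect P) w) (linExt-lin (indicator w) unitDefect P) ⟩
    linExt (λ u → linExt (indicator w) (unitDefect u)) P
      ≡⟨ linExt-cong P (linExt-unitDefect (indicator w)) ⟩
    linExt (λ u → indicator w u - linExt (indicator w) (top u [])) P
      ≡⟨ linExt-- (indicator w) (λ u → linExt (indicator w) (top u [])) P ⟩
    linExt (indicator w) P - linExt (λ u → linExt (indicator w) (top u [])) P
      ≡⟨ cong₂ _-_ (sym (coeff-linExt P w))
           (sym (trans (coeff-linExt (unitProjection P) w) (linExt-lin (indicator w) (λ w → top w []) P))) ⟩
    coeff P w - coeff (unitProjection P) w
      ≡⟨ cong (λ t → coeff P w - t) (short-Li⁻-injective₀ (unitProjection P) projection-short projection-zero w) ⟩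
    coeff P w - 0ℚ
      ≡⟨ ℚP.+-identityʳ (coeff P w) ⟩
    coeff P w ∎)
    where
    projection-short : Short (unitProjection P)
    projection-short = Short-lin (λ w → top w []) P (λ u → top-short u [])
    projection-zero : IsZero (Li⁻ (unitProjection P))
    projection-zero N = trans (Li⁻-unitProjection P N) (Equivalence.to (H⁻-zero⇔Li⁻-zero P) z N)

  span⇒kernel : ∀ P L → P ≈ lin unitDefect L → IsZero (H⁻ P)
  span⇒kernel P L P≈ N = begin
    H⁻ P N                                                  ≡⟨ H⁻-linExt P N ⟩
    linExt (λ w → H⁻w w N) P                                ≡⟨ linExt-resp-≈ _ P (lin unitDefect L) P≈ ⟩
    linExt (λ w → H⁻w w N) (lin unitDefect L)               ≡⟨ linExt-lin _ unitDefect L ⟩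
    linExt (λ u → linExt (λ w → H⁻w w N) (unitDefect u)) L  ≡⟨ linExt-zero L (λ u → H⁻-unitDefect u N) ⟩
    0ℚ                                                      ∎

  kernel-span : ∀ P → IsZero (H⁻ P) ⇔ (∃ λ (L : Poly) → P ≈ lin unitDefect L)
  kernel-span P = mk⇔ (λ z → P , kernel-decomposition P z) (λ { (L , P≈) → span⇒kernel P L P≈ })

-- Corollary 3.  Part (1) is the multiplicativity of leading coefficients applied to
-- Li⁻_{P⊤Q} = Li⁻_P Li⁻_Q; parts (2) and (3) come from TopConsequences; in part (4)
-- H⁻ is a stuffle morphism, onto its span by definition, with kernel that of Li⁻,
-- spanned by the w - w ⊤ 1.
corollary3 : (top : Word → Word → Poly) → TopSpec top →
    ((P Q : Poly) → InYplusY0 P → InYplusY0 Q →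
      ¬ IsZero (Li⁻ P) → ¬ IsZero (Li⁻ Q) →
      (bP bQ : ℚ) → Leading (Li⁻ P) bP → Leading (Li⁻ Q) bQ →
      Leading (Li⁻ (bilin top P Q)) (bP * bQ))
    ×
    ((u v : Word) → (¬ (coeff (top u v) [] ≡ 0ℚ)) ⇔ ((u ≡ []) × (v ≡ [])))
    ×
    (((u v : Word) →
        (top (0 ∷ u) v ≈ top u (0 ∷ v)) ×
        (top u (0 ∷ v) ≈ bilin top (word (0 ∷ [])) (top u v)))
      ×
      ((s₁ s₂ : ℕ) (rest : Word) →
        top (s₁ ∷ s₂ ∷ rest) [] ≈
        sumP s₁ (λ i → scale (ι (s₁ C i)) (top (i ∷ []) ((s₁ ∸ i) ℕ.+ s₂ ∷ rest)))))
    ×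
    (((P Q : Poly) → ∀ N → H⁻ (P ✱ Q) N ≡ H⁻ P N * H⁻ Q N)
      ×
      ((F : Poly) → ∃ λ P → ∀ N → H⁻ P N ≡ H⁻ F N)
      ×
      ((P : Poly) → IsZero (H⁻ P) ⇔ IsZero (Li⁻ P))
      ×
      ((P : Poly) → IsZero (H⁻ P) ⇔
        (∃ λ (L : Poly) → P ≈ lin (λ w → word w ++ neg (top w [])) L)))
corollary3 top spec =
  leadingCoefficients ,
  unit-coefficient≢0 ,
  (y₀-rules , top-unit-expansion) ,
  (H⁻-stuffle , (λ F → F , λ N → refl) , H⁻-zero⇔Li⁻-zero , kernel-span)
  where
  open TopConsequences top spec
  leadingCoefficients : (P Q : Poly) → InYplusY0 P → InYplusY0 Q → ¬ IsZero (Li⁻ P) → ¬ IsZero (Li⁻ Q) →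
    (bP bQ : ℚ) → Leading (Li⁻ P) bP → Leading (Li⁻ Q) bQ → Leading (Li⁻ (bilin top P Q)) (bP * bQ)
  leadingCoefficients P Q _ _ _ _ bP bQ lP lQ =
    Leading-resp (λ N → sym (Li⁻-top-bilin P Q N)) (leading-⋆ (Li⁻ P) (Li⁻ Q) bP bQ lP lQ)
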